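{- There is a constant $c\in\mathbb{N}$ such that there are infinitely many $n\in\mathbb{N}$ satisfying \[ \mathrm{H}(\mathrm{FO}[n])\ge \mathrm{twr}\bigl(\sqrt[5]{n/c}\bigr). \]
   Context: Words are nonempty finite words over $\Sigma=\{l,r\}$, identified with word models (positions with linear order $<$ and unary predicates $P_l,P_r$). FO formulas are over $\{<,P_l,P_r\}$. Size: $\mathrm{sz}(\phi)=1$ for atomic $\phi$; $\mathrm{sz}(\psi\wedge\theta)=\mathrm{sz}(\psi\vee\theta)=\mathrm{sz}(\psi)+\mathrm{sz}(\theta)+1$; $\mathrm{sz}(\neg\psi)=\mathrm{sz}(\exists x\psi)=\mathrm{sz}(\forall x\psi)=\mathrm{sz}(\psi)+1$. $\mathrm{FO}[n]$ is the set of FO formulas of size at most $n$. For a sentence $\phi$, $\nu(\phi)$ is the maximal length of a word satisfying $\phi$, with $\nu(\phi)=0$ if $\phi$ has no models or has arbitrarily long models. The Hanf number is $\mathrm{H}(L)=\max\{\nu(\phi):\phi\in L\}$. $\mathrm{tower}(0)=1$, $\mathrm{tower}(n+1)=2^{\mathrm{tower}(n)}$; for real $x\ge0$, $\mathrm{twr}(x)=\mathrm{tower}(\lceil x\rceil)$. -}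

module Defs where

open import Data.Nat using (ℕ; zero; suc; _+_; _*_; _^_; _≤_; _<ᵇ_; _≡ᵇ_)
open import Data.Fin using (Fin; zero; suc; toℕ)
open import Data.Bool using (Bool; true; false; _∧_; _∨_; not)
open import Data.List using (List; allFin)
open import Data.Bool.ListAction using (any; all)
open import Data.Product using (Σ; _×_; ∃)
open import Data.Sum using (_⊎_)
open import Relation.Binary.PropositionalEquality using (_≡_)
open import Relation.Nullary using (¬_)

data Letter : Set where
  l r : Letter

-- A nonempty word of length (suc k): positions Fin (suc k), letters given by a function.
Word : ℕ → Set
Word k = Fin (suc k) → Letter

Var : Set
Var = ℕ

data Formula : Set where
  lt′  : Var → Var → Formula
  eq′  : Var → Var → Formula
  Pl   : Var → Formula
  Pr   : Var → Formula
  and′ : Formula → Formula → Formula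
  or′  : Formula → Formula → Formula
  neg  : Formula → Formula
  ex   : Var → Formula → Formula
  all′ : Var → Formula → Formula

sz : Formula → ℕ
sz (lt′ x y) = 1
sz (eq′ x y) = 1
sz (Pl x) = 1
sz (Pr x) = 1
sz (and′ φ ψ) = sz φ + sz ψ + 1
sz (or′ φ ψ) = sz φ + sz ψ + 1
sz (neg φ) = sz φ + 1
sz (ex x φ) = sz φ + 1
sz (all′ x φ) = sz φ + 1

free : Var → Formula → Bool
free v (lt′ x y) = (v ≡ᵇ x) ∨ (v ≡ᵇ y)
free v (eq′ x y) = (v ≡ᵇ x) ∨ (v ≡ᵇ y)
free v (Pl x) = v ≡ᵇ x
free v (Pr x) = v ≡ᵇ x
free v (and′ φ ψ) = free v φ ∨ free v ψ
free v (or′ φ ψ) = free v φ ∨ free v ψ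
free v (neg φ) = free v φ
free v (ex x φ) = not (v ≡ᵇ x) ∧ free v φ
free v (all′ x φ) = not (v ≡ᵇ x) ∧ free v φ

IsSentence : Formula → Set
IsSentence φ = ∀ v → free v φ ≡ false

isL isR : Letter → Bool
isL l = true
isL r = false
isR l = false
isR r = true

update : ∀ {n} → (Var → Fin n) → Var → Fin n → (Var → Fin n)
update a x p v with v ≡ᵇ x
... | true = p
... | false = a v

eval : ∀ {n} → (Fin n → Letter) → (Var → Fin n) → Formula → Bool
eval w a (lt′ x y) = toℕ (a x) <ᵇ toℕ (a y)
eval w a (eq′ x y) = toℕ (a x) ≡ᵇ toℕ (a y)
eval w a (Pl x) = isL (w (a x))
eval w a (Pr x) = isR (w (a x))
eval w a (and′ φ ψ) = eval w a φ ∧ eval w a ψ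
eval w a (or′ φ ψ) = eval w a φ ∨ eval w a ψ
eval w a (neg φ) = not (eval w a φ)
eval {n} w a (ex x φ) = any (λ p → eval w (update a x p) φ) (allFin n)
eval {n} w a (all′ x φ) = all (λ p → eval w (update a x p) φ) (allFin n)

-- a (nonempty) word satisfies a sentence (assignment irrelevant for sentences)
_⊨_ : ∀ {k} → Word k → Formula → Set
w ⊨ φ = eval w (λ _ → zero) φ ≡ true

-- φ has a model of length m (m ≥ 1 since words are nonempty)
HasModelOfLength : Formula → ℕ → Set
HasModelOfLength φ m = Σ ℕ λ k → (m ≡ suc k) × Σ (Word k) λ w → w ⊨ φ

IsNu : Formula → ℕ → Set
IsNu φ m =
  (HasModelOfLength φ m × (∀ m′ → HasModelOfLength φ m′ → m′ ≤ m))
  ⊎ ((m ≡ 0) × ((∀ m′ → ¬ HasModelOfLength φ m′)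
                ⊎ (∀ b → Σ ℕ λ m′ → (b ≤ m′) × HasModelOfLength φ m′)))

HanfFOAtLeast : ℕ → ℕ → Set
HanfFOAtLeast n t =
  Σ Formula λ φ → IsSentence φ × (sz φ ≤ n) × Σ ℕ λ m → IsNu φ m × (t ≤ m)

tower : ℕ → ℕ
tower zero = 1
tower (suc n) = 2 ^ tower n

-- k = ⌈ (n / c) ^ (1/5) ⌉  (for c ≥ 1): least k with n ≤ c * k^5
IsCeilFifthRoot : ℕ → ℕ → ℕ → Set
IsCeilFifthRoot n c k = (n ≤ c * k ^ 5) × (∀ j → n ≤ c * j ^ 5 → k ≤ j)

module Submission where

open import Defs
open import Data.Bool using (Bool; true; false; T; _∧_; _∨_; not; if_then_else_) renaming (_≟_ to _≟ᵇ_)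
open import Data.Bool.ListAction using (any; all; or; and)
open import Data.Bool.Properties using (T-∧; T-∨; T-≡)
open import Data.Empty using (⊥; ⊥-elim)
open import Data.Fin using (Fin; zero; suc; toℕ; fromℕ<; funToFin; finToFun; combine)
open import Data.Fin.Properties
  using (toℕ<n; toℕ-fromℕ<; fromℕ<-toℕ; toℕ-injective; 2↔Bool; finToFun-funToFin; funToFin-finToFin;
         combine-injective; injective⇒≤; any?)
open import Data.List using (List; []; _∷_; allFin; map; length; _++_; replicate; intercalate; filter; tabulate)
open import Data.List.Properties
  using (map-cong; map-∘; length-++; length-replicate; length-map; length-tabulate)
open import Data.List.Membership.Propositional using (_∈_; _∉_)
open import Data.List.Membership.Propositional.Properties using (∈-map⁺; ∈-map⁻; ∈-filter⁺; ∈-filter⁻; ∈-allFin)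
open import Data.List.Relation.Unary.All as All using (All)
import Data.List.Relation.Unary.All.Properties as AllP
import Data.List.Relation.Unary.AllPairs as AllPairs
open import Data.List.Relation.Unary.Any using (here; there)
import Data.List.Relation.Unary.Any.Properties as AnyP
open import Data.List.Relation.Unary.Unique.Propositional using (Unique)
import Data.List.Relation.Unary.Unique.Propositional.Properties as UniqueP
open import Data.Nat
open import Data.Nat.Properties
open import Data.Nat.Tactic.RingSolver using (solve; solve-∀)
open import Data.Product using (Σ; ∃; _×_; _,_; proj₁; proj₂)
open import Data.Sum using (_⊎_; inj₁; inj₂; map₂)
open import Function using (_∘_; _⇔_)
open import Function.Bundles using (Equivalence; Inverse; mk⇔)
open import Relation.Binary.Definitions using (tri<; tri≈; tri>)
open import Relation.Binary.PropositionalEquality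
open import Relation.Nullary using (¬_; Dec; yes; no)
open import Relation.Nullary.Decidable using (T?)

-- A word over {l, r} is read as nested blocks: a j-block starts at an l that is the first letter or
-- is preceded by at least j + 1 letters r, and the j-blocks starting inside a (j + 1)-block without a
-- longer run of r in between are its children.  The sentence towerF K, of size O(K³), says that the
-- word is one K-block, has no factor lll, and that sibling j-blocks are pairwise inequivalent for
-- j < K, where the 0-blocks l and ll are inequivalent and (j + 1)-blocks are equivalent when their
-- children realise the same classes.  There are tower (j + 1) classes of j-blocks.
--
-- Upper bound: a position is determined by the classes of the blocks containing it and by its offset
-- in its 0-block, so a model of towerF K has at most (K + 3) · ∏_{j<K} tower (j + 1) letters.
-- Lower bound: joining models of towerF K with separators r^(K+1) gives a model of towerF (K + 1)
-- whose class is the set of classes of the joined words.  Starting from three models of towerF 1,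
-- subfamilies of R + 1 models with distinct classes yield 2 ^ R models with distinct classes; joining
-- all members of the family obtained after t steps gives a model longer than tower t.  With
-- t = N + 1 the sentence is towerF (N + 3), of size at most 869 (N + 1)⁵.

T-∧⁻ : ∀ {a b} → T (a ∧ b) → T a × T b
T-∧⁻ = Equivalence.to T-∧

T-∧⁺ : ∀ {a b} → T a → T b → T (a ∧ b)
T-∧⁺ ta tb = Equivalence.from T-∧ (ta , tb)

T-∨⁻ : ∀ {a b} → T (a ∨ b) → T a ⊎ T b
T-∨⁻ = Equivalence.to T-∨

T-∨⁺ : ∀ {a b} → T a ⊎ T b → T (a ∨ b)
T-∨⁺ = Equivalence.from T-∨

T-not⁻ : ∀ {a} → T (not a) → ¬ T a
T-not⁻ {false} _ ()

T-not⁺ : ∀ {a} → ¬ T a → T (not a)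
T-not⁺ {false} _ = _
T-not⁺ {true} ¬t = ¬t _

T-ext : ∀ {a b} → (T a → T b) → (T b → T a) → a ≡ b
T-ext {false} {false} _ _ = refl
T-ext {false} {true} _ g = ⊥-elim (g _)
T-ext {true} {false} f _ = ⊥-elim (f _)
T-ext {true} {true} _ _ = refl

infixr 4 _⇒ᵇ_

_⇒ᵇ_ : Bool → Bool → Bool
a ⇒ᵇ b = not a ∨ b

⇒ᵇ-elim : ∀ {a b} → T (a ⇒ᵇ b) → T a → T b
⇒ᵇ-elim {true} t _ = t

⇒ᵇ-intro : ∀ {a b} → (T a → T b) → T (a ⇒ᵇ b)
⇒ᵇ-intro {false} _ = _
⇒ᵇ-intro {true} f = f _

≤⇒≮ᵇ : ∀ {x y} → x ≤ y → T (not (y <ᵇ x))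
≤⇒≮ᵇ {x} {y} x≤y = T-not⁺ (≤⇒≯ x≤y ∘ <ᵇ⇒< y x)

≮ᵇ⇒≤ : ∀ {x y} → T (not (y <ᵇ x)) → x ≤ y
≮ᵇ⇒≤ t = ≮⇒≥ (T-not⁻ t ∘ <⇒<ᵇ)

T-isL : ∀ {c} → T (isL c) ⇔ c ≡ l
T-isL {l} = mk⇔ (λ _ → refl) (λ _ → _)
T-isL {r} = mk⇔ (λ ()) (λ ())

T-isR : ∀ {c} → T (isR c) ⇔ c ≡ r
T-isR {l} = mk⇔ (λ ()) (λ ())
T-isR {r} = mk⇔ (λ _ → refl) (λ _ → _)

anyBelow : ℕ → (ℕ → Bool) → Bool
anyBelow n g = any (λ p → g (toℕ p)) (allFin n)

allBelow : ℕ → (ℕ → Bool) → Bool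
allBelow n g = all (λ p → g (toℕ p)) (allFin n)

module Bounded (n : ℕ) where

  anyBelow⁻ : ∀ g → T (anyBelow n g) → ∃ λ p → p < n × T (g p)
  anyBelow⁻ g t = let i , gi = AnyP.tabulate⁻ (AnyP.any⁻ _ _ t) in toℕ i , toℕ<n i , gi

  anyBelow⁺ : ∀ g {p} → p < n → T (g p) → T (anyBelow n g)
  anyBelow⁺ g p<n gp =
    AnyP.any⁺ _ (AnyP.tabulate⁺ (fromℕ< p<n) (subst (T ∘ g) (sym (toℕ-fromℕ< p<n)) gp))

  allBelow⁻ : ∀ g → T (allBelow n g) → ∀ {p} → p < n → T (g p)
  allBelow⁻ g t p<n =
    subst (T ∘ g) (toℕ-fromℕ< p<n) (AllP.tabulate⁻ (AllP.all⁺ _ _ t) (fromℕ< p<n))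

  allBelow⁺ : ∀ g → (∀ {p} → p < n → T (g p)) → T (allBelow n g)
  allBelow⁺ g h = AllP.all⁻ _ (AllP.tabulate⁺ (λ i → h (toℕ<n i)))

-- The sentences towerF K

-- In each builder, b is a variable above all free variables; bound variables are b, suc b, ….

infixr 7 _∧F_
infixr 6 _∨F_
infixr 5 _⇒F_

_∧F_ _∨F_ _⇒F_ : Formula → Formula → Formula
_∧F_ = and′
_∨F_ = or′
φ ⇒F ψ = neg φ ∨F ψ

_≤F_ : Var → Var → Formula
x ≤F y = neg (lt′ y x)

succF : Var → Var → Var → Formula
succF b x y = lt′ x y ∧F neg (ex b (lt′ x b ∧F lt′ b y))

runF : ℕ → Var → Var → Formula
runF zero b z = Pr z
runF (suc k) b z = Pr z ∧F ex b (succF (suc b) z b ∧F runF k (suc b) b)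

firstF lastF : Var → Var → Formula
firstF b u = neg (ex b (lt′ b u))
lastF b u = neg (ex b (lt′ u b))

onlyRF : Var → Var → Var → Formula
onlyRF b z u = all′ b (z ≤F b ∧F lt′ b u ⇒F Pr b)

precededF : ℕ → Var → Var → Formula
precededF j b u = ex b (lt′ b u ∧F runF j (suc b) b ∧F onlyRF (suc b) b u)

blockStartF : ℕ → Var → Var → Formula
blockStartF j b u = Pl u ∧F (firstF b u ∨F precededF j b u)

noRunF : ℕ → Var → Var → Var → Formula
noRunF k b x u = all′ b (x ≤F b ∧F lt′ b u ⇒F neg (runF k (suc b) b))

childF : ℕ → Var → Var → Var → Formula
childF j b x u = x ≤F u ∧F blockStartF j b u ∧F noRunF (suc j) b x u

nextLF : Var → Var → Formula
nextLF b x = ex b (succF (suc b) x b ∧F Pl b)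

pairF : Var → Var → Var → Var → Formula
pairF a c x y = eq′ a x ∧F eq′ c y ∨F eq′ a y ∧F eq′ c x

equivF : ℕ → Var → Var → Var → Formula
hasEquivChildF : ℕ → Var → Var → Var → Formula

includedF : ℕ → Var → Var → Var → Formula
includedF j b a c = all′ b (childF j (suc b) a b ⇒F hasEquivChildF j (suc b) c b)

includedPairF : ℕ → Var → Var → Var → Var → Formula
includedPairF j b a x y = all′ b (pairF a b x y ⇒F includedF j (suc b) a b)

equivF zero b x y = nextLF b x ∧F nextLF b y ∨F neg (nextLF b x) ∧F neg (nextLF b y)
-- One copy of equivF j checks both inclusions, by quantifying over (a, c) ∈ {(x, y), (y, x)}; this
-- keeps sz (equivF j) quadratic in j.
equivF (suc j) b x y = all′ b (includedPairF j (suc b) b x y)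

hasEquivChildF j b c u = ex b (childF j (suc b) c b ∧F equivF j (suc b) u b)

siblingsF : ℕ → Var → Var → Var → Formula
siblingsF j b u v = blockStartF j b u ∧F blockStartF j b v ∧F lt′ u v ∧F noRunF (suc j) b u v

distinctFromF : ℕ → Var → Var → Formula
distinctFromF j b u = all′ b (siblingsF j (suc b) u b ⇒F neg (equivF j (suc b) u b))

distinctF : ℕ → Var → Formula
distinctF j b = all′ b (distinctFromF j (suc b) b)

distinctBelowF : ℕ → Var → Formula
distinctBelowF zero b = all′ b (eq′ b b)
distinctBelowF (suc j) b = distinctF j b ∧F distinctBelowF j b

lllF : Var → Var → Formula
lllF b x = Pl x ∧F ex b (succF (suc b) x b ∧F Pl b ∧F nextLF (suc b) b)

formatF : ℕ → Var → Formula
formatF K b =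
  all′ b (firstF (suc b) b ⇒F Pl b) ∧F all′ b (lastF (suc b) b ⇒F Pl b) ∧F
  neg (ex b (lllF (suc b) b)) ∧F neg (ex b (runF K (suc b) b))

towerF : ℕ → Formula
towerF K = formatF K 0 ∧F distinctBelowF K 0

module BoolSemantics (n : ℕ) (f : ℕ → Letter) where

  isLᵇ isRᵇ : ℕ → Bool
  isLᵇ x = isL (f x)
  isRᵇ x = isR (f x)

  succᵇ : ℕ → ℕ → Bool
  succᵇ x y = (x <ᵇ y) ∧ not (anyBelow n λ z → (x <ᵇ z) ∧ (z <ᵇ y))

  runᵇ : ℕ → ℕ → Bool
  runᵇ zero z = isRᵇ z
  runᵇ (suc k) z = isRᵇ z ∧ anyBelow n λ z′ → succᵇ z z′ ∧ runᵇ k z′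

  firstᵇ lastᵇ : ℕ → Bool
  firstᵇ u = not (anyBelow n λ z → z <ᵇ u)
  lastᵇ u = not (anyBelow n λ z → u <ᵇ z)

  onlyRᵇ : ℕ → ℕ → Bool
  onlyRᵇ z u = allBelow n λ y → not (y <ᵇ z) ∧ (y <ᵇ u) ⇒ᵇ isRᵇ y

  precededᵇ : ℕ → ℕ → Bool
  precededᵇ j u = anyBelow n λ z → (z <ᵇ u) ∧ runᵇ j z ∧ onlyRᵇ z u

  blockStartᵇ : ℕ → ℕ → Bool
  blockStartᵇ j u = isLᵇ u ∧ (firstᵇ u ∨ precededᵇ j u)

  noRunᵇ : ℕ → ℕ → ℕ → Bool
  noRunᵇ k x u = allBelow n λ z → not (z <ᵇ x) ∧ (z <ᵇ u) ⇒ᵇ not (runᵇ k z)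

  childᵇ : ℕ → ℕ → ℕ → Bool
  childᵇ j x u = not (u <ᵇ x) ∧ blockStartᵇ j u ∧ noRunᵇ (suc j) x u

  nextLᵇ : ℕ → Bool
  nextLᵇ x = anyBelow n λ z → succᵇ x z ∧ isLᵇ z

  pairᵇ : ℕ → ℕ → ℕ → ℕ → Bool
  pairᵇ a c x y = (a ≡ᵇ x) ∧ (c ≡ᵇ y) ∨ (a ≡ᵇ y) ∧ (c ≡ᵇ x)

  equivᵇ : ℕ → ℕ → ℕ → Bool
  hasEquivChildᵇ : ℕ → ℕ → ℕ → Bool

  includedᵇ : ℕ → ℕ → ℕ → Bool
  includedᵇ j a c = allBelow n λ u → childᵇ j a u ⇒ᵇ hasEquivChildᵇ j c u

  includedPairᵇ : ℕ → ℕ → ℕ → ℕ → Bool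
  includedPairᵇ j a x y = allBelow n λ c → pairᵇ a c x y ⇒ᵇ includedᵇ j a c

  equivᵇ zero x y = nextLᵇ x ∧ nextLᵇ y ∨ not (nextLᵇ x) ∧ not (nextLᵇ y)
  equivᵇ (suc j) x y = allBelow n λ a → includedPairᵇ j a x y

  hasEquivChildᵇ j c u = anyBelow n λ v → childᵇ j c v ∧ equivᵇ j u v

  siblingsᵇ : ℕ → ℕ → ℕ → Bool
  siblingsᵇ j u v = blockStartᵇ j u ∧ blockStartᵇ j v ∧ (u <ᵇ v) ∧ noRunᵇ (suc j) u v

  distinctFromᵇ : ℕ → ℕ → Bool
  distinctFromᵇ j u = allBelow n λ v → siblingsᵇ j u v ⇒ᵇ not (equivᵇ j u v)

  distinctᵇ : ℕ → Bool
  distinctᵇ j = allBelow n (distinctFromᵇ j)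

  distinctBelowᵇ : ℕ → Bool
  distinctBelowᵇ zero = allBelow n λ x → x ≡ᵇ x
  distinctBelowᵇ (suc j) = distinctᵇ j ∧ distinctBelowᵇ j

  lllᵇ : ℕ → Bool
  lllᵇ x = isLᵇ x ∧ anyBelow n λ y → succᵇ x y ∧ isLᵇ y ∧ nextLᵇ y

  formatᵇ : ℕ → Bool
  formatᵇ K =
    allBelow n (λ x → firstᵇ x ⇒ᵇ isLᵇ x) ∧ allBelow n (λ x → lastᵇ x ⇒ᵇ isLᵇ x) ∧
    not (anyBelow n lllᵇ) ∧ not (anyBelow n (runᵇ K))

  towerᵇ : ℕ → Bool
  towerᵇ K = formatᵇ K ∧ distinctBelowᵇ K

update-same : ∀ {n} (a : Var → Fin n) x p → update a x p x ≡ p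
update-same a x p with x ≡ᵇ x | ≡⇒≡ᵇ x x refl
... | true | _ = refl

update-below : ∀ {n} (a : Var → Fin n) x p {v} → v < x → update a x p v ≡ a v
update-below a x p {v} v<x with v ≡ᵇ x in eq
... | true = ⊥-elim (<-irrefl (≡ᵇ⇒≡ v x (subst T (sym eq) _)) v<x)
... | false = refl

module Eval {n : ℕ} (w : Fin n → Letter) (f : ℕ → Letter) (w≗f : ∀ i → w i ≡ f (toℕ i)) where
  open BoolSemantics n f

  -- A record, so that a, b, φ and G are inferred from the signature of a where-clause.
  record BinderEval (a : Var → Fin n) (b : Var) (φ : Formula) (G : ℕ → Bool) : Set where
    field pointwise : ∀ p → eval w (update a b p) φ ≡ G (toℕ p)
  open BinderEval

  eval-ex : ∀ {a b φ G} → BinderEval a b φ G → eval w a (ex b φ) ≡ anyBelow n G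
  eval-ex e = cong or (map-cong (pointwise e) (allFin n))

  eval-all : ∀ {a b φ G} → BinderEval a b φ G → eval w a (all′ b φ) ≡ allBelow n G
  eval-all e = cong and (map-cong (pointwise e) (allFin n))

  eval-Pl : ∀ a x → eval w a (Pl x) ≡ isLᵇ (toℕ (a x))
  eval-Pl a x = cong isL (w≗f (a x))

  eval-Pr : ∀ a x → eval w a (Pr x) ≡ isRᵇ (toℕ (a x))
  eval-Pr a x = cong isR (w≗f (a x))

  eval-succF : ∀ a {b x y} → x < b → y < b →
               eval w a (succF b x y) ≡ succᵇ (toℕ (a x)) (toℕ (a y))
  eval-succF a {b} {x} {y} x<b y<b = cong (λ t → (toℕ (a x) <ᵇ toℕ (a y)) ∧ not t) (eval-ex between)
    where
    between : BinderEval a b (lt′ x b ∧F lt′ b y) (λ z → (toℕ (a x) <ᵇ z) ∧ (z <ᵇ toℕ (a y)))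
    between .pointwise p rewrite update-below a b p x<b | update-below a b p y<b | update-same a b p = refl

  eval-runF : ∀ k a {b z} → z < b → eval w a (runF k b z) ≡ runᵇ k (toℕ (a z))
  eval-runF zero a {z = z} _ = eval-Pr a z
  eval-runF (suc k) a {b} {z} z<b = cong₂ _∧_ (eval-Pr a z) (eval-ex next)
    where
    next : BinderEval a b (succF (suc b) z b ∧F runF k (suc b) b) (λ y → succᵇ (toℕ (a z)) y ∧ runᵇ k y)
    next .pointwise p rewrite eval-succF (update a b p) (m<n⇒m<1+n z<b) (n<1+n b)
                 | eval-runF k (update a b p) (n<1+n b)
                 | update-below a b p z<b | update-same a b p = refl

  eval-firstF : ∀ a {b u} → u < b → eval w a (firstF b u) ≡ firstᵇ (toℕ (a u))
  eval-firstF a {b} {u} u<b = cong not (eval-ex earlier)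
    where
    earlier : BinderEval a b (lt′ b u) (λ z → z <ᵇ toℕ (a u))
    earlier .pointwise p rewrite update-below a b p u<b | update-same a b p = refl

  eval-lastF : ∀ a {b u} → u < b → eval w a (lastF b u) ≡ lastᵇ (toℕ (a u))
  eval-lastF a {b} {u} u<b = cong not (eval-ex later)
    where
    later : BinderEval a b (lt′ u b) (λ z → toℕ (a u) <ᵇ z)
    later .pointwise p rewrite update-below a b p u<b | update-same a b p = refl

  eval-onlyRF : ∀ a {b z u} → z < b → u < b →
                eval w a (onlyRF b z u) ≡ onlyRᵇ (toℕ (a z)) (toℕ (a u))
  eval-onlyRF a {b} {z} {u} z<b u<b = eval-all inside
    where
    inside : BinderEval a b (z ≤F b ∧F lt′ b u ⇒F Pr b)
                            (λ y → not (y <ᵇ toℕ (a z)) ∧ (y <ᵇ toℕ (a u)) ⇒ᵇ isRᵇ y)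
    inside .pointwise p rewrite eval-Pr (update a b p) b
                   | update-below a b p z<b | update-below a b p u<b | update-same a b p = refl

  eval-precededF : ∀ j a {b u} → u < b → eval w a (precededF j b u) ≡ precededᵇ j (toℕ (a u))
  eval-precededF j a {b} {u} u<b = eval-ex start
    where
    start : BinderEval a b (lt′ b u ∧F runF j (suc b) b ∧F onlyRF (suc b) b u)
                           (λ z → (z <ᵇ toℕ (a u)) ∧ runᵇ j z ∧ onlyRᵇ z (toℕ (a u)))
    start .pointwise p rewrite eval-runF j (update a b p) (n<1+n b)
                  | eval-onlyRF (update a b p) (n<1+n b) (m<n⇒m<1+n u<b)
                  | update-below a b p u<b | update-same a b p = refl

  eval-blockStartF : ∀ j a {b u} → u < b → eval w a (blockStartF j b u) ≡ blockStartᵇ j (toℕ (a u))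
  eval-blockStartF j a {u = u} u<b =
    cong₂ _∧_ (eval-Pl a u) (cong₂ _∨_ (eval-firstF a u<b) (eval-precededF j a u<b))

  eval-noRunF : ∀ k a {b x u} → x < b → u < b →
                eval w a (noRunF k b x u) ≡ noRunᵇ k (toℕ (a x)) (toℕ (a u))
  eval-noRunF k a {b} {x} {u} x<b u<b = eval-all inside
    where
    inside : BinderEval a b (x ≤F b ∧F lt′ b u ⇒F neg (runF k (suc b) b))
                            (λ z → not (z <ᵇ toℕ (a x)) ∧ (z <ᵇ toℕ (a u)) ⇒ᵇ not (runᵇ k z))
    inside .pointwise p rewrite eval-runF k (update a b p) (n<1+n b)
                   | update-below a b p x<b | update-below a b p u<b | update-same a b p = refl

  eval-childF : ∀ j a {b x u} → x < b → u < b →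
                eval w a (childF j b x u) ≡ childᵇ j (toℕ (a x)) (toℕ (a u))
  eval-childF j a {x = x} {u} x<b u<b =
    cong (not (toℕ (a u) <ᵇ toℕ (a x)) ∧_)
         (cong₂ _∧_ (eval-blockStartF j a u<b) (eval-noRunF (suc j) a x<b u<b))

  eval-nextLF : ∀ a {b x} → x < b → eval w a (nextLF b x) ≡ nextLᵇ (toℕ (a x))
  eval-nextLF a {b} {x} x<b = eval-ex next
    where
    next : BinderEval a b (succF (suc b) x b ∧F Pl b) (λ z → succᵇ (toℕ (a x)) z ∧ isLᵇ z)
    next .pointwise p rewrite eval-succF (update a b p) (m<n⇒m<1+n x<b) (n<1+n b) | eval-Pl (update a b p) b
                 | update-below a b p x<b | update-same a b p = refl

  eval-equivF : ∀ j a {b x y} → x < b → y < b →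
             eval w a (equivF j b x y) ≡ equivᵇ j (toℕ (a x)) (toℕ (a y))
  eval-hasEquivChildF : ∀ j a {b c u} → c < b → u < b →
                     eval w a (hasEquivChildF j b c u) ≡ hasEquivChildᵇ j (toℕ (a c)) (toℕ (a u))

  eval-includedF : ∀ j a {b x y} → x < b → y < b →
                   eval w a (includedF j b x y) ≡ includedᵇ j (toℕ (a x)) (toℕ (a y))
  eval-includedF j a {b} {x} {y} x<b y<b = eval-all child
    where
    child : BinderEval a b (childF j (suc b) x b ⇒F hasEquivChildF j (suc b) y b)
                           (λ u → childᵇ j (toℕ (a x)) u ⇒ᵇ hasEquivChildᵇ j (toℕ (a y)) u)
    child .pointwise p rewrite eval-childF j (update a b p) (m<n⇒m<1+n x<b) (n<1+n b)
                  | eval-hasEquivChildF j (update a b p) (m<n⇒m<1+n y<b) (n<1+n b)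
                  | update-below a b p x<b | update-below a b p y<b | update-same a b p = refl

  eval-includedPairF : ∀ j a {b c x y} → c < b → x < b → y < b →
                       eval w a (includedPairF j b c x y) ≡
                       includedPairᵇ j (toℕ (a c)) (toℕ (a x)) (toℕ (a y))
  eval-includedPairF j a {b} {c} {x} {y} c<b x<b y<b = eval-all other
    where
    other : BinderEval a b (pairF c b x y ⇒F includedF j (suc b) c b)
                           (λ d → pairᵇ (toℕ (a c)) d (toℕ (a x)) (toℕ (a y)) ⇒ᵇ includedᵇ j (toℕ (a c)) d)
    other .pointwise p rewrite eval-includedF j (update a b p) (m<n⇒m<1+n c<b) (n<1+n b)
                  | update-below a b p c<b | update-below a b p x<b | update-below a b p y<b
                  | update-same a b p = refl

  eval-equivF zero a x<b y<b
    rewrite eval-nextLF a x<b | eval-nextLF a y<b = refl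
  eval-equivF (suc j) a {b} {x} {y} x<b y<b = eval-all first
    where
    first : BinderEval a b (includedPairF j (suc b) b x y) (λ c → includedPairᵇ j c (toℕ (a x)) (toℕ (a y)))
    first .pointwise p rewrite eval-includedPairF j (update a b p) (n<1+n b) (m<n⇒m<1+n x<b) (m<n⇒m<1+n y<b)
                  | update-below a b p x<b | update-below a b p y<b | update-same a b p = refl

  eval-hasEquivChildF j a {b} {c} {u} c<b u<b = eval-ex equivalent
    where
    equivalent : BinderEval a b (childF j (suc b) c b ∧F equivF j (suc b) u b)
                                (λ v → childᵇ j (toℕ (a c)) v ∧ equivᵇ j (toℕ (a u)) v)
    equivalent .pointwise p rewrite eval-childF j (update a b p) (m<n⇒m<1+n c<b) (n<1+n b)
                       | eval-equivF j (update a b p) (m<n⇒m<1+n u<b) (n<1+n b)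
                       | update-below a b p c<b | update-below a b p u<b | update-same a b p = refl

  eval-siblingsF : ∀ j a {b u v} → u < b → v < b →
                   eval w a (siblingsF j b u v) ≡ siblingsᵇ j (toℕ (a u)) (toℕ (a v))
  eval-siblingsF j a {u = u} {v} u<b v<b =
    cong₂ _∧_ (eval-blockStartF j a u<b)
      (cong₂ _∧_ (eval-blockStartF j a v<b)
        (cong ((toℕ (a u) <ᵇ toℕ (a v)) ∧_) (eval-noRunF (suc j) a u<b v<b)))

  eval-distinctFromF : ∀ j a {b u} → u < b → eval w a (distinctFromF j b u) ≡ distinctFromᵇ j (toℕ (a u))
  eval-distinctFromF j a {b} {u} u<b = eval-all other
    where
    other : BinderEval a b (siblingsF j (suc b) u b ⇒F neg (equivF j (suc b) u b))
                           (λ v → siblingsᵇ j (toℕ (a u)) v ⇒ᵇ not (equivᵇ j (toℕ (a u)) v))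
    other .pointwise p rewrite eval-siblingsF j (update a b p) (m<n⇒m<1+n u<b) (n<1+n b)
                             | eval-equivF j (update a b p) (m<n⇒m<1+n u<b) (n<1+n b)
                             | update-below a b p u<b | update-same a b p = refl

  eval-distinctF : ∀ j a b → eval w a (distinctF j b) ≡ distinctᵇ j
  eval-distinctF j a b = eval-all first
    where
    first : BinderEval a b (distinctFromF j (suc b) b) (distinctFromᵇ j)
    first .pointwise p rewrite eval-distinctFromF j (update a b p) (n<1+n b) | update-same a b p = refl

  eval-distinctBelowF : ∀ j a b → eval w a (distinctBelowF j b) ≡ distinctBelowᵇ j
  eval-distinctBelowF zero a b = eval-all reflexive
    where
    reflexive : BinderEval a b (eq′ b b) (λ x → x ≡ᵇ x)
    reflexive .pointwise p rewrite update-same a b p = refl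
  eval-distinctBelowF (suc j) a b = cong₂ _∧_ (eval-distinctF j a b) (eval-distinctBelowF j a b)

  eval-lllF : ∀ a {b x} → x < b → eval w a (lllF b x) ≡ lllᵇ (toℕ (a x))
  eval-lllF a {b} {x} x<b = cong₂ _∧_ (eval-Pl a x) (eval-ex second)
    where
    second : BinderEval a b (succF (suc b) x b ∧F Pl b ∧F nextLF (suc b) b)
                            (λ y → succᵇ (toℕ (a x)) y ∧ isLᵇ y ∧ nextLᵇ y)
    second .pointwise p rewrite eval-succF (update a b p) (m<n⇒m<1+n x<b) (n<1+n b)
                              | eval-Pl (update a b p) b | eval-nextLF (update a b p) (n<1+n b)
                              | update-below a b p x<b | update-same a b p = refl

  eval-formatF : ∀ K a b → eval w a (formatF K b) ≡ formatᵇ K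
  eval-formatF K a b =
    cong₂ _∧_ (eval-all firstL) (cong₂ _∧_ (eval-all lastL)
      (cong₂ _∧_ (cong not (eval-ex lll)) (cong not (eval-ex run))))
    where
    firstL : BinderEval a b (firstF (suc b) b ⇒F Pl b) (λ x → firstᵇ x ⇒ᵇ isLᵇ x)
    firstL .pointwise p rewrite eval-firstF (update a b p) (n<1+n b) | eval-Pl (update a b p) b
                              | update-same a b p = refl
    lastL : BinderEval a b (lastF (suc b) b ⇒F Pl b) (λ x → lastᵇ x ⇒ᵇ isLᵇ x)
    lastL .pointwise p rewrite eval-lastF (update a b p) (n<1+n b) | eval-Pl (update a b p) b
                             | update-same a b p = refl
    lll : BinderEval a b (lllF (suc b) b) lllᵇ
    lll .pointwise p rewrite eval-lllF (update a b p) (n<1+n b) | update-same a b p = refl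
    run : BinderEval a b (runF K (suc b) b) (runᵇ K)
    run .pointwise p rewrite eval-runF K (update a b p) (n<1+n b) | update-same a b p = refl

  eval-towerF : ∀ K a → eval w a (towerF K) ≡ towerᵇ K
  eval-towerF K a = cong₂ _∧_ (eval-formatF K a 0) (eval-distinctBelowF K a 0)

record FreeBelow (b : ℕ) (φ : Formula) : Set where
  field freeVar< : ∀ v → T (free v φ) → v < b
open FreeBelow

free-var : ∀ {b x v} → x < b → T (v ≡ᵇ x) → v < b
free-var {v = v} x<b t = subst (_< _) (sym (≡ᵇ⇒≡ v _ t)) x<b

free-vars : ∀ {b x y v} → x < b → y < b → T ((v ≡ᵇ x) ∨ (v ≡ᵇ y)) → v < b
free-vars {x = x} {v = v} x<b y<b t with T-∨⁻ {v ≡ᵇ x} t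
... | inj₁ t = free-var x<b t
... | inj₂ t = free-var y<b t

free-lt : ∀ {b x y} → x < b → y < b → FreeBelow b (lt′ x y)
free-lt x<b y<b .freeVar< v = free-vars x<b y<b

free-eq : ∀ {b x y} → x < b → y < b → FreeBelow b (eq′ x y)
free-eq x<b y<b .freeVar< v = free-vars x<b y<b

free-Pl : ∀ {b x} → x < b → FreeBelow b (Pl x)
free-Pl x<b .freeVar< v = free-var x<b

free-Pr : ∀ {b x} → x < b → FreeBelow b (Pr x)
free-Pr x<b .freeVar< v = free-var x<b

free-∨ : ∀ {b φ ψ} → FreeBelow b φ → FreeBelow b ψ → FreeBelow b (or′ φ ψ)
free-∨ {φ = φ} hφ hψ .freeVar< v t with T-∨⁻ {free v φ} t
... | inj₁ t = hφ .freeVar< v t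
... | inj₂ t = hψ .freeVar< v t

free-∧ : ∀ {b φ ψ} → FreeBelow b φ → FreeBelow b ψ → FreeBelow b (and′ φ ψ)
free-∧ {φ = φ} hφ hψ .freeVar< v t with T-∨⁻ {free v φ} t
... | inj₁ t = hφ .freeVar< v t
... | inj₂ t = hψ .freeVar< v t

free-neg : ∀ {b φ} → FreeBelow b φ → FreeBelow b (neg φ)
free-neg hφ .freeVar< = hφ .freeVar<

free-⇒ : ∀ {b φ ψ} → FreeBelow b φ → FreeBelow b ψ → FreeBelow b (φ ⇒F ψ)
free-⇒ hφ hψ = free-∨ (free-neg hφ) hψ

free-binder : ∀ {b φ v} → FreeBelow (suc b) φ → T (not (v ≡ᵇ b) ∧ free v φ) → v < b
free-binder {b} {φ} {v} hφ t with T-∧⁻ {not (v ≡ᵇ b)} t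
... | v≢b , t′ with m≤n⇒m<n∨m≡n (s≤s⁻¹ (hφ .freeVar< v t′))
...   | inj₁ v<b = v<b
...   | inj₂ v≡b = ⊥-elim (T-not⁻ v≢b (≡⇒≡ᵇ v b v≡b))

free-ex : ∀ {b φ} → FreeBelow (suc b) φ → FreeBelow b (ex b φ)
free-ex hφ .freeVar< v = free-binder hφ

free-all : ∀ {b φ} → FreeBelow (suc b) φ → FreeBelow b (all′ b φ)
free-all hφ .freeVar< v = free-binder hφ

free-≤F : ∀ {b x y} → x < b → y < b → FreeBelow b (x ≤F y)
free-≤F x<b y<b = free-neg (free-lt y<b x<b)

free-succF : ∀ {b x y} → x < b → y < b → FreeBelow b (succF b x y)
free-succF {b} x<b y<b =
  free-∧ (free-lt x<b y<b)
         (free-neg (free-ex (free-∧ (free-lt (m<n⇒m<1+n x<b) (n<1+n b)) (free-lt (n<1+n b) (m<n⇒m<1+n y<b)))))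

free-runF : ∀ k {b z} → z < b → FreeBelow b (runF k b z)
free-runF zero z<b = free-Pr z<b
free-runF (suc k) {b} z<b =
  free-∧ (free-Pr z<b)
         (free-ex (free-∧ (free-succF (m<n⇒m<1+n z<b) (n<1+n b)) (free-runF k (n<1+n b))))

free-firstF : ∀ {b u} → u < b → FreeBelow b (firstF b u)
free-firstF {b} u<b = free-neg (free-ex (free-lt (n<1+n b) (m<n⇒m<1+n u<b)))

free-lastF : ∀ {b u} → u < b → FreeBelow b (lastF b u)
free-lastF {b} u<b = free-neg (free-ex (free-lt (m<n⇒m<1+n u<b) (n<1+n b)))

free-onlyRF : ∀ {b z u} → z < b → u < b → FreeBelow b (onlyRF b z u)
free-onlyRF {b} z<b u<b =
  free-all (free-⇒ (free-∧ (free-≤F (m<n⇒m<1+n z<b) (n<1+n b)) (free-lt (n<1+n b) (m<n⇒m<1+n u<b)))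
                   (free-Pr (n<1+n b)))

free-precededF : ∀ j {b u} → u < b → FreeBelow b (precededF j b u)
free-precededF j {b} u<b =
  free-ex (free-∧ (free-lt (n<1+n b) (m<n⇒m<1+n u<b))
                  (free-∧ (free-runF j (n<1+n b)) (free-onlyRF (n<1+n b) (m<n⇒m<1+n u<b))))

free-blockStartF : ∀ j {b u} → u < b → FreeBelow b (blockStartF j b u)
free-blockStartF j u<b = free-∧ (free-Pl u<b) (free-∨ (free-firstF u<b) (free-precededF j u<b))

free-noRunF : ∀ k {b x u} → x < b → u < b → FreeBelow b (noRunF k b x u)
free-noRunF k {b} x<b u<b =
  free-all (free-⇒ (free-∧ (free-≤F (m<n⇒m<1+n x<b) (n<1+n b)) (free-lt (n<1+n b) (m<n⇒m<1+n u<b)))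
                   (free-neg (free-runF k (n<1+n b))))

free-childF : ∀ j {b x u} → x < b → u < b → FreeBelow b (childF j b x u)
free-childF j x<b u<b =
  free-∧ (free-≤F x<b u<b) (free-∧ (free-blockStartF j u<b) (free-noRunF (suc j) x<b u<b))

free-nextLF : ∀ {b x} → x < b → FreeBelow b (nextLF b x)
free-nextLF {b} x<b = free-ex (free-∧ (free-succF (m<n⇒m<1+n x<b) (n<1+n b)) (free-Pl (n<1+n b)))

free-pairF : ∀ {b a c x y} → a < b → c < b → x < b → y < b → FreeBelow b (pairF a c x y)
free-pairF a<b c<b x<b y<b =
  free-∨ (free-∧ (free-eq a<b x<b) (free-eq c<b y<b)) (free-∧ (free-eq a<b y<b) (free-eq c<b x<b))

free-equivF : ∀ j {b x y} → x < b → y < b → FreeBelow b (equivF j b x y)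
free-hasEquivChildF : ∀ j {b c u} → c < b → u < b → FreeBelow b (hasEquivChildF j b c u)

free-includedF : ∀ j {b x y} → x < b → y < b → FreeBelow b (includedF j b x y)
free-includedF j {b} x<b y<b =
  free-all (free-⇒ (free-childF j (m<n⇒m<1+n x<b) (n<1+n b)) (free-hasEquivChildF j (m<n⇒m<1+n y<b) (n<1+n b)))

free-includedPairF : ∀ j {b c x y} → c < b → x < b → y < b → FreeBelow b (includedPairF j b c x y)
free-includedPairF j {b} c<b x<b y<b =
  free-all (free-⇒ (free-pairF (m<n⇒m<1+n c<b) (n<1+n b) (m<n⇒m<1+n x<b) (m<n⇒m<1+n y<b))
                   (free-includedF j (m<n⇒m<1+n c<b) (n<1+n b)))

free-equivF zero x<b y<b =
  free-∨ (free-∧ (free-nextLF x<b) (free-nextLF y<b))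
         (free-∧ (free-neg (free-nextLF x<b)) (free-neg (free-nextLF y<b)))
free-equivF (suc j) {b} x<b y<b =
  free-all (free-includedPairF j (n<1+n b) (m<n⇒m<1+n x<b) (m<n⇒m<1+n y<b))

free-hasEquivChildF j {b} c<b u<b =
  free-ex (free-∧ (free-childF j (m<n⇒m<1+n c<b) (n<1+n b)) (free-equivF j (m<n⇒m<1+n u<b) (n<1+n b)))

free-siblingsF : ∀ j {b u v} → u < b → v < b → FreeBelow b (siblingsF j b u v)
free-siblingsF j u<b v<b =
  free-∧ (free-blockStartF j u<b)
         (free-∧ (free-blockStartF j v<b) (free-∧ (free-lt u<b v<b) (free-noRunF (suc j) u<b v<b)))

free-distinctFromF : ∀ j {b u} → u < b → FreeBelow b (distinctFromF j b u)
free-distinctFromF j {b} u<b =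
  free-all (free-⇒ (free-siblingsF j (m<n⇒m<1+n u<b) (n<1+n b)) (free-neg (free-equivF j (m<n⇒m<1+n u<b) (n<1+n b))))

free-distinctBelowF : ∀ j b → FreeBelow b (distinctBelowF j b)
free-distinctBelowF zero b = free-all (free-eq (n<1+n b) (n<1+n b))
free-distinctBelowF (suc j) b =
  free-∧ (free-all (free-distinctFromF j (n<1+n b))) (free-distinctBelowF j b)

free-lllF : ∀ {b x} → x < b → FreeBelow b (lllF b x)
free-lllF {b} x<b =
  free-∧ (free-Pl x<b)
         (free-ex (free-∧ (free-succF (m<n⇒m<1+n x<b) (n<1+n b))
                          (free-∧ (free-Pl (n<1+n b)) (free-nextLF (n<1+n b)))))

free-formatF : ∀ K b → FreeBelow b (formatF K b)
free-formatF K b =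
  free-∧ (free-all (free-⇒ (free-firstF (n<1+n b)) (free-Pl (n<1+n b))))
    (free-∧ (free-all (free-⇒ (free-lastF (n<1+n b)) (free-Pl (n<1+n b))))
      (free-∧ (free-neg (free-ex (free-lllF (n<1+n b)))) (free-neg (free-ex (free-runF K (n<1+n b))))))

towerF-sentence : ∀ K → IsSentence (towerF K)
towerF-sentence K v with free v (towerF K) in e
... | false = refl
... | true = ⊥-elim (n≮0 (free-∧ (free-formatF K 0) (free-distinctBelowF K 0) .freeVar< v (subst T (sym e) _)))

sz-runF : ∀ k b z → sz (runF k b z) ≡ 11 * k + 1
sz-runF zero b z = refl
sz-runF (suc k) b z rewrite sz-runF k (suc b) b = solve (k ∷ [])

-- The λ in each proof is sz of the builder with the sizes of its subformulas abstracted.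

sz-blockStartF : ∀ j b u → sz (blockStartF j b u) ≡ 11 * j + 19
sz-blockStartF j b u =
  trans (cong (λ r → 1 + (3 + (1 + (r + 8 + 1) + 1 + 1) + 1) + 1) (sz-runF j (suc b) b)) (solve (j ∷ []))

sz-noRunF : ∀ k b x u → sz (noRunF k b x u) ≡ 11 * k + 9
sz-noRunF k b x u = trans (cong (λ r → 4 + 1 + (r + 1) + 1 + 1) (sz-runF k (suc b) b)) (solve (k ∷ []))

sz-childF : ∀ j b x u → sz (childF j b x u) ≡ 22 * j + 43
sz-childF j b x u =
  trans (cong₂ (λ s t → 2 + (s + t + 1) + 1) (sz-blockStartF j b u) (sz-noRunF (suc j) b x u)) (solve (j ∷ []))

sz-equivF : ∀ j b x y → sz (equivF j b x y) ≡ 22 * j * j + 80 * j + 45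
sz-equivF zero b x y = refl
sz-equivF (suc j) b x y =
  trans (cong₂ (λ c h → 7 + 1 + (c + 1 + h + 1 + 1) + 1 + 1 + 1)
               (sz-childF j (3 + b) b (2 + b))
               (cong₂ (λ c e → c + e + 1 + 1) (sz-childF j (4 + b) (suc b) (3 + b))
                                               (sz-equivF j (4 + b) (2 + b) (3 + b))))
        (solve (j ∷ []))

sz-siblingsF : ∀ j b u v → sz (siblingsF j b u v) ≡ 33 * j + 62
sz-siblingsF j b u v =
  trans (cong₂ (λ s t → s + (s + (1 + t + 1) + 1) + 1) (sz-blockStartF j b u) (sz-noRunF (suc j) b u v))
        (solve (j ∷ []))

sz-distinctF : ∀ j b → sz (distinctF j b) ≡ 22 * j * j + 113 * j + 112
sz-distinctF j b =
  trans (cong₂ (λ s e → s + 1 + (e + 1) + 1 + 1 + 1)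
               (sz-siblingsF j (2 + b) b (suc b)) (sz-equivF j (2 + b) b (suc b)))
        (solve (j ∷ []))

6*[a+d+1]≡6*[a+1]+6*d : ∀ a d → 6 * (a + d + 1) ≡ 6 * (a + 1) + 6 * d
6*[a+d+1]≡6*[a+1]+6*d = solve-∀

-- Summing the quadratic sizes of distinctF j over j < K gives a cubic with denominator 6.
sz-distinctBelowF : ∀ K b → 6 * sz (distinctBelowF K b) ≡ 44 * K * K * K + 273 * K * K + 361 * K + 12
sz-distinctBelowF zero b = refl
sz-distinctBelowF (suc K) b = begin
  6 * (sz (distinctF K b) + sz (distinctBelowF K b) + 1)
    ≡⟨ cong (λ d → 6 * (d + sz (distinctBelowF K b) + 1)) (sz-distinctF K b) ⟩
  6 * (22 * K * K + 113 * K + 112 + sz (distinctBelowF K b) + 1)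
    ≡⟨ 6*[a+d+1]≡6*[a+1]+6*d (22 * K * K + 113 * K + 112) (sz (distinctBelowF K b)) ⟩
  6 * (22 * K * K + 113 * K + 112 + 1) + 6 * sz (distinctBelowF K b)
    ≡⟨ cong (6 * (22 * K * K + 113 * K + 112 + 1) +_) (sz-distinctBelowF K b) ⟩
  6 * (22 * K * K + 113 * K + 112 + 1) + (44 * K * K * K + 273 * K * K + 361 * K + 12)
    ≡⟨ solve (K ∷ []) ⟩
  44 * (1 + K) * (1 + K) * (1 + K) + 273 * (1 + K) * (1 + K) + 361 * (1 + K) + 12 ∎
  where open ≡-Reasoning

sz-towerF : ∀ K → 6 * sz (towerF K) ≡ 44 * K * K * K + 273 * K * K + 427 * K + 288
sz-towerF K = begin
  6 * (sz (formatF K 0) + sz (distinctBelowF K 0) + 1)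
    ≡⟨ 6*[a+d+1]≡6*[a+1]+6*d (sz (formatF K 0)) (sz (distinctBelowF K 0)) ⟩
  6 * (sz (formatF K 0) + 1) + 6 * sz (distinctBelowF K 0)
    ≡⟨ cong₂ (λ r d → 6 * (7 + (7 + (25 + (r + 1 + 1) + 1) + 1) + 1 + 1) + d)
             (sz-runF K 1 0) (sz-distinctBelowF K 0) ⟩
  6 * (7 + (7 + (25 + (11 * K + 1 + 1 + 1) + 1) + 1) + 1 + 1) + (44 * K * K * K + 273 * K * K + 361 * K + 12)
    ≡⟨ solve (K ∷ []) ⟩
  44 * K * K * K + 273 * K * K + 427 * K + 288 ∎
  where open ≡-Reasoning

-- Classes of blocks

bit : Bool → Fin 2
bit = Inverse.from 2↔Bool

encode : ∀ {m} → (Fin m → Bool) → Fin (2 ^ m)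
encode g = funToFin (bit ∘ g)

decode : ∀ {m} → Fin (2 ^ m) → Fin m → Bool
decode k i = Inverse.to 2↔Bool (finToFun k i)

funToFin-cong : ∀ {m k} {g h : Fin m → Fin k} → (∀ i → g i ≡ h i) → funToFin g ≡ funToFin h
funToFin-cong {zero} e = refl
funToFin-cong {suc m} e = cong₂ combine (e zero) (funToFin-cong (e ∘ suc))

encode-cong : ∀ {m} {g h : Fin m → Bool} → (∀ i → g i ≡ h i) → encode g ≡ encode h
encode-cong e = funToFin-cong (cong bit ∘ e)

decode-encode : ∀ {m} (g : Fin m → Bool) i → decode (encode g) i ≡ g i
decode-encode g i =
  trans (cong (Inverse.to 2↔Bool) (finToFun-funToFin (bit ∘ g) i)) (Inverse.strictlyInverseˡ 2↔Bool (g i))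

encode-decode : ∀ {m} (k : Fin (2 ^ m)) → encode (decode {m} k) ≡ k
encode-decode {m} k =
  trans (funToFin-cong (Inverse.strictlyInverseʳ 2↔Bool ∘ finToFun {m = 2} {n = m} k)) (funToFin-finToFin {m} k)

encode-injective : ∀ {m} {g h : Fin m → Bool} → encode g ≡ encode h → ∀ i → g i ≡ h i
encode-injective {g = g} {h} e i =
  trans (sym (decode-encode g i)) (trans (cong (λ k → decode k i) e) (decode-encode h i))

decode-injective : ∀ {m} {k k′ : Fin (2 ^ m)} → (∀ (i : Fin m) → decode k i ≡ decode k′ i) → k ≡ k′
decode-injective {m} {k} {k′} e = trans (sym (encode-decode {m} k)) (trans (encode-cong e) (encode-decode {m} k′))

module Classes (n : ℕ) (f : ℕ → Letter) where
  open BoolSemantics n f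
  open Bounded n

  -- A 0-block is l or ll; a (j + 1)-block is coded by the set of classes of its children.
  class : ∀ j → ℕ → Fin (tower (suc j))
  childClasses : ∀ j → ℕ → Fin (tower (suc j)) → Bool

  class zero x = bit (nextLᵇ x)
  class (suc j) x = encode (childClasses j x)

  childClasses j x c = anyBelow n λ u → childᵇ j x u ∧ (toℕ (class j u) ≡ᵇ toℕ c)

  childClasses⁻ : ∀ j x c → T (childClasses j x c) → ∃ λ u → u < n × T (childᵇ j x u) × class j u ≡ c
  childClasses⁻ j x c t =
    let u , u<n , cu = anyBelow⁻ (λ u → childᵇ j x u ∧ (toℕ (class j u) ≡ᵇ toℕ c)) t
        child , same = T-∧⁻ cu
    in u , u<n , child , toℕ-injective (≡ᵇ⇒≡ _ _ same)

  childClasses⁺ : ∀ j x {u} → u < n → T (childᵇ j x u) → T (childClasses j x (class j u))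
  childClasses⁺ j x {u} u<n child =
    anyBelow⁺ (λ v → childᵇ j x v ∧ (toℕ (class j v) ≡ᵇ toℕ (class j u))) u<n
              (T-∧⁺ child (≡⇒≡ᵇ (toℕ (class j u)) _ refl))

  pairᵇ-refl : ∀ x y → T (pairᵇ x y x y)
  pairᵇ-refl x y = T-∨⁺ (inj₁ (T-∧⁺ (≡⇒≡ᵇ x x refl) (≡⇒≡ᵇ y y refl)))

  pairᵇ-swap : ∀ x y → T (pairᵇ y x x y)
  pairᵇ-swap x y = T-∨⁺ (inj₂ (T-∧⁺ (≡⇒≡ᵇ y y refl) (≡⇒≡ᵇ x x refl)))

  pairᵇ⁻ : ∀ {a c x y} → T (pairᵇ a c x y) → (a ≡ x × c ≡ y) ⊎ (a ≡ y × c ≡ x)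
  pairᵇ⁻ {a} {c} {x} {y} t with T-∨⁻ {(a ≡ᵇ x) ∧ (c ≡ᵇ y)} t
  ... | inj₁ t′ = let a≡x , c≡y = T-∧⁻ {a ≡ᵇ x} t′ in inj₁ (≡ᵇ⇒≡ a x a≡x , ≡ᵇ⇒≡ c y c≡y)
  ... | inj₂ t′ = let a≡y , c≡x = T-∧⁻ {a ≡ᵇ y} t′ in inj₂ (≡ᵇ⇒≡ a y a≡y , ≡ᵇ⇒≡ c x c≡x)

  ChildClasses⊆ : ℕ → ℕ → ℕ → Set
  ChildClasses⊆ j a c = ∀ k → T (childClasses j a k) → T (childClasses j c k)

  equiv⇔sameClass : ∀ j {x y} → x < n → y < n → T (equivᵇ j x y) ⇔ (class j x ≡ class j y)
  included⇔⊆ : ∀ j a c → T (includedᵇ j a c) ⇔ ChildClasses⊆ j a c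

  equiv⇔sameClass zero {x} {y} _ _ with nextLᵇ x | nextLᵇ y
  ... | true  | true  = mk⇔ (λ _ → refl) (λ _ → _)
  ... | false | false = mk⇔ (λ _ → refl) (λ _ → _)
  ... | true  | false = mk⇔ (λ ()) (λ ())
  ... | false | true  = mk⇔ (λ ()) (λ ())
  equiv⇔sameClass (suc j) {x} {y} x<n y<n = mk⇔ to from
    where
    included : ∀ {a c} → T (equivᵇ (suc j) x y) → a < n → c < n → T (pairᵇ a c x y) → ChildClasses⊆ j a c
    included {a} {c} t a<n c<n p =
      Equivalence.to (included⇔⊆ j a c)
        (⇒ᵇ-elim (allBelow⁻ (λ c → pairᵇ a c x y ⇒ᵇ includedᵇ j a c)
                            (allBelow⁻ (λ a → includedPairᵇ j a x y) t a<n) c<n) p)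
    to : T (equivᵇ (suc j) x y) → class (suc j) x ≡ class (suc j) y
    to t = encode-cong λ k → T-ext (included {x} {y} t x<n y<n (pairᵇ-refl x y) k)
                                    (included {y} {x} t y<n x<n (pairᵇ-swap x y) k)
    ⊆-of : ∀ {a c} → class (suc j) a ≡ class (suc j) c → ChildClasses⊆ j a c
    ⊆-of e k = subst T (encode-injective e k)
    from : class (suc j) x ≡ class (suc j) y → T (equivᵇ (suc j) x y)
    from e = allBelow⁺ (λ a → includedPairᵇ j a x y) λ {a} _ →
               allBelow⁺ (λ c → pairᵇ a c x y ⇒ᵇ includedᵇ j a c) λ {c} _ → ⇒ᵇ-intro λ p →
                 Equivalence.from (included⇔⊆ j a c) (pairCase (pairᵇ⁻ {a} {c} p))
      where
      pairCase : ∀ {a c} → (a ≡ x × c ≡ y) ⊎ (a ≡ y × c ≡ x) → ChildClasses⊆ j a c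
      pairCase (inj₁ (refl , refl)) = ⊆-of {x} {y} e
      pairCase (inj₂ (refl , refl)) = ⊆-of {y} {x} (sym e)

  included⇔⊆ j a c = mk⇔ to from
    where
    to : T (includedᵇ j a c) → ChildClasses⊆ j a c
    to t k tk =
      let u , u<n , au , uk = childClasses⁻ j a k tk
          v , v<n , cv-uv = anyBelow⁻ (λ v → childᵇ j c v ∧ equivᵇ j u v)
                              (⇒ᵇ-elim (allBelow⁻ (λ u → childᵇ j a u ⇒ᵇ hasEquivChildᵇ j c u) t u<n) au)
          cv , uv = T-∧⁻ cv-uv
      in subst (T ∘ childClasses j c) (trans (sym (Equivalence.to (equiv⇔sameClass j u<n v<n) uv)) uk)
               (childClasses⁺ j c v<n cv)
    from : ChildClasses⊆ j a c → T (includedᵇ j a c)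
    from h = allBelow⁺ (λ u → childᵇ j a u ⇒ᵇ hasEquivChildᵇ j c u) λ {u} u<n → ⇒ᵇ-intro λ au →
      let v , v<n , cv , vu = childClasses⁻ j c (class j u) (h (class j u) (childClasses⁺ j a u<n au))
      in anyBelow⁺ (λ v → childᵇ j c v ∧ equivᵇ j u v) v<n
                   (T-∧⁺ cv (Equivalence.from (equiv⇔sameClass j u<n v<n) (sym vu)))

module Structure (n : ℕ) (f : ℕ → Letter) (pad : ∀ p → n ≤ p → f p ≡ l) where
  open BoolSemantics n f
  open Bounded n
  open Classes n f

  IsL IsR : ℕ → Set
  IsL p = f p ≡ l
  IsR p = f p ≡ r

  L≢R : ∀ {p} → IsL p → IsR p → ⊥
  L≢R pl pr with () ← trans (sym pl) pr

  letter : ∀ p → IsL p ⊎ IsR p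
  letter p with f p
  ... | l = inj₁ refl
  ... | r = inj₂ refl

  IsR⇒<n : ∀ {p} → IsR p → p < n
  IsR⇒<n {p} pr with p <? n
  ... | yes p<n = p<n
  ... | no p≮n = ⊥-elim (L≢R (pad p (≮⇒≥ p≮n)) pr)

  isLᵇ⁻ : ∀ {p} → T (isLᵇ p) → IsL p
  isLᵇ⁻ = Equivalence.to T-isL

  isLᵇ⁺ : ∀ {p} → IsL p → T (isLᵇ p)
  isLᵇ⁺ = Equivalence.from T-isL

  isRᵇ⁻ : ∀ {p} → T (isRᵇ p) → IsR p
  isRᵇ⁻ = Equivalence.to T-isR

  isRᵇ⁺ : ∀ {p} → IsR p → T (isRᵇ p)
  isRᵇ⁺ = Equivalence.from T-isR

  Run : ℕ → ℕ → Set
  Run k z = ∀ i → i ≤ k → IsR (z + i)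

  Run-head : ∀ {k z} → Run k z → IsR z
  Run-head {z = z} run = subst IsR (+-identityʳ z) (run 0 z≤n)

  Run-tail : ∀ {k z} → Run (suc k) z → Run k (suc z)
  Run-tail {z = z} run i i≤k = subst IsR (+-suc z i) (run (suc i) (s≤s i≤k))

  Run-cons : ∀ {k z} → IsR z → Run k (suc z) → Run (suc k) z
  Run-cons {z = z} rz run zero _ = subst IsR (sym (+-identityʳ z)) rz
  Run-cons {z = z} rz run (suc i) (s≤s i≤k) = subst IsR (sym (+-suc z i)) (run i i≤k)

  Run-zero : ∀ {z} → IsR z → Run 0 z
  Run-zero {z} rz zero _ = subst IsR (sym (+-identityʳ z)) rz

  Run-weaken : ∀ {k k′ z} → k′ ≤ k → Run k z → Run k′ z
  Run-weaken k′≤k run i i≤k′ = run i (≤-trans i≤k′ k′≤k)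

  OnlyR : ℕ → ℕ → Set
  OnlyR z u = ∀ y → z ≤ y → y < u → IsR y

  Preceded : ℕ → ℕ → Set
  Preceded j u = ∃ λ z → z < u × Run j z × OnlyR z u

  BlockStart : ℕ → ℕ → Set
  BlockStart j u = IsL u × (u ≡ 0 ⊎ Preceded j u)

  NoRun : ℕ → ℕ → ℕ → Set
  NoRun k x u = ∀ z → x ≤ z → z < u → ¬ Run k z

  Child : ℕ → ℕ → ℕ → Set
  Child j x u = x ≤ u × BlockStart j u × NoRun (suc j) x u

  Siblings : ℕ → ℕ → ℕ → Set
  Siblings j u v = BlockStart j u × BlockStart j v × u < v × NoRun (suc j) u v

  NextL : ℕ → Set
  NextL x = suc x < n × IsL (suc x)

  Distinct : ℕ → Set
  Distinct j = ∀ {u v} → v < n → Siblings j u v → class j u ≢ class j v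

  DistinctBelow : ℕ → Set
  DistinctBelow K = ∀ {j} → j < K → Distinct j

  NoLLL : Set
  NoLLL = ∀ x → suc (suc x) < n → IsL x → IsL (suc x) → IsL (suc (suc x)) → ⊥

  BlockStart-weaken : ∀ {j u} → BlockStart (suc j) u → BlockStart j u
  BlockStart-weaken (lu , inj₁ u≡0) = lu , inj₁ u≡0
  BlockStart-weaken {j} (lu , inj₂ (z , z<u , run , only)) = lu , inj₂ (z , z<u , Run-weaken (n≤1+n j) run , only)

  BlockStart-top : ∀ {K u} → (∀ z → ¬ Run K z) → BlockStart K u → u ≡ 0
  BlockStart-top no-run (_ , inj₁ u≡0) = u≡0
  BlockStart-top no-run (_ , inj₂ (z , _ , run , _)) = ⊥-elim (no-run z run)

  firstL-after : ∀ d {z} → IsL (suc z + d) → ∃ λ y → z < y × y ≤ suc z + d × IsL y × OnlyR (suc z) y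
  firstL-after d {z} l-end with letter (suc z)
  ... | inj₁ lsz = suc z , ≤-refl , m≤m+n (suc z) d , lsz , λ y sz≤y y<sz → ⊥-elim (<⇒≱ y<sz sz≤y)
  firstL-after zero {z} l-end | inj₂ rsz = ⊥-elim (L≢R (subst IsL (+-identityʳ (suc z)) l-end) rsz)
  firstL-after (suc d) {z} l-end | inj₂ rsz =
    let y , sz<y , y≤ , ly , only = firstL-after d {suc z} (subst IsL (+-suc (suc z) d) l-end)
    in y , <-trans (n<1+n z) sz<y , ≤-trans y≤ (≤-reflexive (sym (+-suc (suc z) d))) , ly , extend only
    where
    extend : ∀ {y} → OnlyR (suc (suc z)) y → OnlyR (suc z) y
    extend only y′ sz≤y′ y′<y with m≤n⇒m<n∨m≡n sz≤y′
    ... | inj₁ sz<y′ = only y′ sz<y′ y′<y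
    ... | inj₂ refl = rsz

  BlockStart-after-run : ∀ {k z u} → Run k z → z < u → IsL u → ∃ λ y → z < y × y ≤ u × BlockStart k y
  BlockStart-after-run {k} {z} {u} run z<u lu =
    let y , z<y , y≤ , ly , only = firstL-after (u ∸ suc z) (subst IsL (sym (m+[n∸m]≡n z<u)) lu)
    in y , z<y , subst (y ≤_) (m+[n∸m]≡n z<u) y≤ , ly , inj₂ (z , z<y , run , include-run only)
    where
    include-run : ∀ {y} → OnlyR (suc z) y → OnlyR z y
    include-run only y′ z≤y′ y′<y with m≤n⇒m<n∨m≡n z≤y′
    ... | inj₁ z<y′ = only y′ z<y′ y′<y
    ... | inj₂ refl = Run-head run

  children⇒siblings : ∀ {j x u v} → Child j x u → Child j x v → u < v → Siblings j u v
  children⇒siblings (x≤u , su , _) (_ , sv , noRun) u<v =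
    su , sv , u<v , λ z u≤z z<v → noRun z (≤-trans x≤u u≤z) z<v

  Distinct⇒child-unique : ∀ {j x u v} → Distinct j → u < n → v < n → Child j x u → Child j x v →
                          class j u ≡ class j v → u ≡ v
  Distinct⇒child-unique {u = u} {v} distinct u<n v<n cu cv same with <-cmp u v
  ... | tri≈ _ u≡v _ = u≡v
  ... | tri< u<v _ _ = ⊥-elim (distinct v<n (children⇒siblings cu cv u<v) same)
  ... | tri> _ _ v<u = ⊥-elim (distinct u<n (children⇒siblings cv cu v<u) (sym same))

  record Format (K : ℕ) : Set where
    field
      first-L : 0 < n → IsL 0
      last-L : ∀ u → suc u ≡ n → IsL u
      no-lll : NoLLL
      no-run : ∀ z → ¬ Run K z

  record Tower (K : ℕ) : Set where
    field
      format : Format K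
      distinct : DistinctBelow K

  succᵇ⁻ : ∀ {x y} → y ≤ n → T (succᵇ x y) → y ≡ suc x
  succᵇ⁻ {x} {y} y≤n t with T-∧⁻ {x <ᵇ y} t
  ... | x<y , nothingBetween with m≤n⇒m<n∨m≡n (<ᵇ⇒< x y x<y)
  ...   | inj₂ sx≡y = sym sx≡y
  ...   | inj₁ sx<y = ⊥-elim (T-not⁻ nothingBetween
            (anyBelow⁺ (λ z → (x <ᵇ z) ∧ (z <ᵇ y)) (<-≤-trans sx<y y≤n)
                       (T-∧⁺ (<⇒<ᵇ (n<1+n x)) (<⇒<ᵇ sx<y))))

  succᵇ⁺ : ∀ x → T (succᵇ x (suc x))
  succᵇ⁺ x = T-∧⁺ (<⇒<ᵇ (n<1+n x)) (T-not⁺ λ t →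
    let z , _ , between = anyBelow⁻ (λ z → (x <ᵇ z) ∧ (z <ᵇ suc x)) t
        x<z , z<sx = T-∧⁻ {x <ᵇ z} between
    in <⇒≱ (<ᵇ⇒< x z x<z) (s≤s⁻¹ (<ᵇ⇒< z (suc x) z<sx)))

  runᵇ⁻ : ∀ k {z} → T (runᵇ k z) → Run k z
  runᵇ⁻ zero t = Run-zero (isRᵇ⁻ t)
  runᵇ⁻ (suc k) {z} t =
    let rz , rest = T-∧⁻ {isRᵇ z} t
        z′ , z′<n , succ-run = anyBelow⁻ (λ z′ → succᵇ z z′ ∧ runᵇ k z′) rest
        succ , run = T-∧⁻ {succᵇ z z′} succ-run
    in Run-cons (isRᵇ⁻ rz) (subst (Run k) (succᵇ⁻ (<⇒≤ z′<n) succ) (runᵇ⁻ k run))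

  runᵇ⁺ : ∀ k {z} → Run k z → T (runᵇ k z)
  runᵇ⁺ zero run = isRᵇ⁺ (Run-head run)
  runᵇ⁺ (suc k) {z} run =
    T-∧⁺ (isRᵇ⁺ (Run-head run))
         (anyBelow⁺ (λ z′ → succᵇ z z′ ∧ runᵇ k z′) (IsR⇒<n (Run-head (Run-tail run)))
                    (T-∧⁺ (succᵇ⁺ z) (runᵇ⁺ k (Run-tail run))))

  firstᵇ⁻ : ∀ {u} → u < n → T (firstᵇ u) → u ≡ 0
  firstᵇ⁻ {zero} _ _ = refl
  firstᵇ⁻ {suc u} u<n t = ⊥-elim (T-not⁻ t (anyBelow⁺ (λ z → z <ᵇ suc u) (<-trans z<s u<n) _))

  firstᵇ-zero : T (firstᵇ 0)
  firstᵇ-zero = T-not⁺ λ t → let z , _ , z<0 = anyBelow⁻ (λ z → z <ᵇ 0) t in n≮0 (<ᵇ⇒< z 0 z<0)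

  lastᵇ⁻ : ∀ {u} → u < n → T (lastᵇ u) → suc u ≡ n
  lastᵇ⁻ {u} u<n t with suc u <? n
  ... | yes su<n = ⊥-elim (T-not⁻ t (anyBelow⁺ (λ z → u <ᵇ z) su<n (<⇒<ᵇ (n<1+n u))))
  ... | no su≮n = ≤-antisym u<n (≮⇒≥ su≮n)

  lastᵇ⁺ : ∀ {u} → suc u ≡ n → T (lastᵇ u)
  lastᵇ⁺ {u} refl = T-not⁺ λ t →
    let z , z<n , u<z = anyBelow⁻ (λ z → u <ᵇ z) t in <⇒≱ z<n (<ᵇ⇒< u z u<z)

  onlyRᵇ⁻ : ∀ {z u} → u ≤ n → T (onlyRᵇ z u) → OnlyR z u
  onlyRᵇ⁻ {z} {u} u≤n t y z≤y y<u =
    isRᵇ⁻ (⇒ᵇ-elim (allBelow⁻ (λ y → not (y <ᵇ z) ∧ (y <ᵇ u) ⇒ᵇ isRᵇ y) t (<-≤-trans y<u u≤n))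
                   (T-∧⁺ (≤⇒≮ᵇ z≤y) (<⇒<ᵇ y<u)))

  onlyRᵇ⁺ : ∀ {z u} → OnlyR z u → T (onlyRᵇ z u)
  onlyRᵇ⁺ {z} {u} only = allBelow⁺ (λ y → not (y <ᵇ z) ∧ (y <ᵇ u) ⇒ᵇ isRᵇ y) λ {y} _ → ⇒ᵇ-intro λ t →
    let z≤y , y<u = T-∧⁻ {not (y <ᵇ z)} t in isRᵇ⁺ (only y (≮ᵇ⇒≤ z≤y) (<ᵇ⇒< y u y<u))

  precededᵇ⁻ : ∀ j {u} → u ≤ n → T (precededᵇ j u) → Preceded j u
  precededᵇ⁻ j {u} u≤n t =
    let z , _ , zt = anyBelow⁻ (λ z → (z <ᵇ u) ∧ runᵇ j z ∧ onlyRᵇ z u) t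
        z<u , run-only = T-∧⁻ {z <ᵇ u} zt
        run , only = T-∧⁻ {runᵇ j z} run-only
    in z , <ᵇ⇒< z u z<u , runᵇ⁻ j run , onlyRᵇ⁻ u≤n only

  precededᵇ⁺ : ∀ j {u} → u ≤ n → Preceded j u → T (precededᵇ j u)
  precededᵇ⁺ j {u} u≤n (z , z<u , run , only) =
    anyBelow⁺ (λ z → (z <ᵇ u) ∧ runᵇ j z ∧ onlyRᵇ z u) (<-≤-trans z<u u≤n)
              (T-∧⁺ (<⇒<ᵇ z<u) (T-∧⁺ (runᵇ⁺ j run) (onlyRᵇ⁺ only)))

  blockStartᵇ⁻ : ∀ j {u} → u < n → T (blockStartᵇ j u) → BlockStart j u
  blockStartᵇ⁻ j {u} u<n t with T-∧⁻ {isLᵇ u} t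
  ... | lu , rest with T-∨⁻ {firstᵇ u} rest
  ...   | inj₁ first = isLᵇ⁻ lu , inj₁ (firstᵇ⁻ u<n first)
  ...   | inj₂ preceded = isLᵇ⁻ lu , inj₂ (precededᵇ⁻ j (<⇒≤ u<n) preceded)

  blockStartᵇ⁺ : ∀ j {u} → u < n → BlockStart j u → T (blockStartᵇ j u)
  blockStartᵇ⁺ j u<n (lu , inj₁ refl) = T-∧⁺ (isLᵇ⁺ lu) (T-∨⁺ (inj₁ firstᵇ-zero))
  blockStartᵇ⁺ j u<n (lu , inj₂ preceded) = T-∧⁺ (isLᵇ⁺ lu) (T-∨⁺ (inj₂ (precededᵇ⁺ j (<⇒≤ u<n) preceded)))

  noRunᵇ⁻ : ∀ k {x u} → T (noRunᵇ k x u) → NoRun k x u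
  noRunᵇ⁻ k {x} {u} t z x≤z z<u run =
    T-not⁻ (⇒ᵇ-elim (allBelow⁻ (λ z → not (z <ᵇ x) ∧ (z <ᵇ u) ⇒ᵇ not (runᵇ k z)) t (IsR⇒<n (Run-head run)))
                    (T-∧⁺ (≤⇒≮ᵇ x≤z) (<⇒<ᵇ z<u)))
           (runᵇ⁺ k run)

  noRunᵇ⁺ : ∀ k {x u} → NoRun k x u → T (noRunᵇ k x u)
  noRunᵇ⁺ k {x} {u} noRun = allBelow⁺ (λ z → not (z <ᵇ x) ∧ (z <ᵇ u) ⇒ᵇ not (runᵇ k z)) λ {z} _ → ⇒ᵇ-intro λ t →
    let x≤z , z<u = T-∧⁻ {not (z <ᵇ x)} t in T-not⁺ (noRun z (≮ᵇ⇒≤ x≤z) (<ᵇ⇒< z u z<u) ∘ runᵇ⁻ k)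

  childᵇ⁻ : ∀ j {x u} → u < n → T (childᵇ j x u) → Child j x u
  childᵇ⁻ j {x} {u} u<n t =
    let x≤u , rest = T-∧⁻ {not (u <ᵇ x)} t
        start , noRun = T-∧⁻ {blockStartᵇ j u} rest
    in ≮ᵇ⇒≤ x≤u , blockStartᵇ⁻ j u<n start , noRunᵇ⁻ (suc j) noRun

  childᵇ⁺ : ∀ j {x u} → u < n → Child j x u → T (childᵇ j x u)
  childᵇ⁺ j u<n (x≤u , start , noRun) =
    T-∧⁺ (≤⇒≮ᵇ x≤u) (T-∧⁺ (blockStartᵇ⁺ j u<n start) (noRunᵇ⁺ (suc j) noRun))

  siblingsᵇ⁻ : ∀ j {u v} → v < n → T (siblingsᵇ j u v) → Siblings j u v
  siblingsᵇ⁻ j {u} {v} v<n t =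
    let su , rest = T-∧⁻ {blockStartᵇ j u} t
        sv , rest′ = T-∧⁻ {blockStartᵇ j v} rest
        u<v , noRun = T-∧⁻ {u <ᵇ v} rest′
    in blockStartᵇ⁻ j (<-trans (<ᵇ⇒< u v u<v) v<n) su , blockStartᵇ⁻ j v<n sv , <ᵇ⇒< u v u<v ,
       noRunᵇ⁻ (suc j) noRun

  siblingsᵇ⁺ : ∀ j {u v} → v < n → Siblings j u v → T (siblingsᵇ j u v)
  siblingsᵇ⁺ j v<n (su , sv , u<v , noRun) =
    T-∧⁺ (blockStartᵇ⁺ j (<-trans u<v v<n) su)
         (T-∧⁺ (blockStartᵇ⁺ j v<n sv) (T-∧⁺ (<⇒<ᵇ u<v) (noRunᵇ⁺ (suc j) noRun)))

  nextLᵇ⁻ : ∀ {x} → T (nextLᵇ x) → NextL x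
  nextLᵇ⁻ {x} t =
    let z , z<n , zt = anyBelow⁻ (λ z → succᵇ x z ∧ isLᵇ z) t
        succ , lz = T-∧⁻ {succᵇ x z} zt
        z≡sx = succᵇ⁻ (<⇒≤ z<n) succ
    in subst (_< n) z≡sx z<n , subst IsL z≡sx (isLᵇ⁻ lz)

  nextLᵇ⁺ : ∀ {x} → NextL x → T (nextLᵇ x)
  nextLᵇ⁺ {x} (sx<n , lsx) = anyBelow⁺ (λ z → succᵇ x z ∧ isLᵇ z) sx<n (T-∧⁺ (succᵇ⁺ x) (isLᵇ⁺ lsx))

  distinctᵇ⁻ : ∀ j → T (distinctᵇ j) → Distinct j
  distinctᵇ⁻ j t {u} {v} v<n sib same =
    T-not⁻ (⇒ᵇ-elim (allBelow⁻ (λ v → siblingsᵇ j u v ⇒ᵇ not (equivᵇ j u v))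
                              (allBelow⁻ (distinctFromᵇ j) t u<n) v<n)
                   (siblingsᵇ⁺ j v<n sib))
           (Equivalence.from (equiv⇔sameClass j u<n v<n) same)
    where
    u<n : u < n
    u<n = <-trans (proj₁ (proj₂ (proj₂ sib))) v<n

  distinctᵇ⁺ : ∀ j → Distinct j → T (distinctᵇ j)
  distinctᵇ⁺ j distinct = allBelow⁺ (distinctFromᵇ j) λ {u} u<n →
    allBelow⁺ (λ v → siblingsᵇ j u v ⇒ᵇ not (equivᵇ j u v)) λ {v} v<n → ⇒ᵇ-intro λ sib →
      T-not⁺ (distinct v<n (siblingsᵇ⁻ j v<n sib) ∘ Equivalence.to (equiv⇔sameClass j u<n v<n))

  distinctBelowᵇ⁻ : ∀ K → T (distinctBelowᵇ K) → DistinctBelow K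
  distinctBelowᵇ⁻ (suc K) t {j} j<sK with T-∧⁻ {distinctᵇ K} t | m≤n⇒m<n∨m≡n (s≤s⁻¹ j<sK)
  ... | top , _ | inj₂ refl = distinctᵇ⁻ j top
  ... | _ , rest | inj₁ j<K = distinctBelowᵇ⁻ K rest j<K

  distinctBelowᵇ⁺ : ∀ K → DistinctBelow K → T (distinctBelowᵇ K)
  distinctBelowᵇ⁺ zero _ = allBelow⁺ (λ x → x ≡ᵇ x) λ {x} _ → ≡⇒≡ᵇ x x refl
  distinctBelowᵇ⁺ (suc K) distinct =
    T-∧⁺ (distinctᵇ⁺ K (distinct (n<1+n K))) (distinctBelowᵇ⁺ K (distinct ∘ m<n⇒m<1+n))

  noLLLᵇ⁻ : T (not (anyBelow n lllᵇ)) → NoLLL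
  noLLLᵇ⁻ t x ssx<n lx lsx lssx = T-not⁻ t
    (anyBelow⁺ lllᵇ (<-trans (n<1+n x) sx<n)
      (T-∧⁺ (isLᵇ⁺ lx) (anyBelow⁺ (λ y → succᵇ x y ∧ isLᵇ y ∧ nextLᵇ y) sx<n
        (T-∧⁺ (succᵇ⁺ x) (T-∧⁺ (isLᵇ⁺ lsx) (nextLᵇ⁺ (ssx<n , lssx)))))))
    where
    sx<n : suc x < n
    sx<n = <-trans (n<1+n (suc x)) ssx<n

  noLLLᵇ⁺ : NoLLL → T (not (anyBelow n lllᵇ))
  noLLLᵇ⁺ noLLL = T-not⁺ λ t →
    let x , _ , xt = anyBelow⁻ lllᵇ t
        lx , rest = T-∧⁻ {isLᵇ x} xt
        y , y<n , yt = anyBelow⁻ (λ y → succᵇ x y ∧ isLᵇ y ∧ nextLᵇ y) rest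
        succ , rest′ = T-∧⁻ {succᵇ x y} yt
        ly , nly = T-∧⁻ {isLᵇ y} rest′
        ssx<n , lssx = nextLᵇ⁻ nly
        y≡sx = succᵇ⁻ (<⇒≤ y<n) succ
    in noLLL x (subst (λ y → suc y < n) y≡sx ssx<n) (isLᵇ⁻ lx) (subst IsL y≡sx (isLᵇ⁻ ly))
             (subst (IsL ∘ suc) y≡sx lssx)

  formatᵇ⁻ : ∀ K → T (formatᵇ K) → Format K
  formatᵇ⁻ K t =
    let firstL , t₁ = T-∧⁻ {allBelow n (λ x → firstᵇ x ⇒ᵇ isLᵇ x)} t
        lastL , t₂ = T-∧⁻ {allBelow n (λ x → lastᵇ x ⇒ᵇ isLᵇ x)} t₁
        lll , noRun = T-∧⁻ {not (anyBelow n lllᵇ)} t₂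
    in record
      { first-L = λ 0<n → isLᵇ⁻ (⇒ᵇ-elim (allBelow⁻ (λ x → firstᵇ x ⇒ᵇ isLᵇ x) firstL 0<n) firstᵇ-zero)
      ; last-L = λ u su≡n → isLᵇ⁻ (⇒ᵇ-elim (allBelow⁻ (λ x → lastᵇ x ⇒ᵇ isLᵇ x) lastL (≤-reflexive su≡n))
                                            (lastᵇ⁺ su≡n))
      ; no-lll = noLLLᵇ⁻ lll
      ; no-run = λ z run → T-not⁻ noRun (anyBelow⁺ (runᵇ K) (IsR⇒<n (Run-head run)) (runᵇ⁺ K run))
      }

  formatᵇ⁺ : ∀ K → Format K → T (formatᵇ K)
  formatᵇ⁺ K format =
    T-∧⁺ (allBelow⁺ (λ x → firstᵇ x ⇒ᵇ isLᵇ x) λ x<n → ⇒ᵇ-intro λ first →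
            isLᵇ⁺ (subst IsL (sym (firstᵇ⁻ x<n first)) (first-L (≤-<-trans z≤n x<n))))
    (T-∧⁺ (allBelow⁺ (λ x → lastᵇ x ⇒ᵇ isLᵇ x) λ x<n → ⇒ᵇ-intro λ last → isLᵇ⁺ (last-L _ (lastᵇ⁻ x<n last)))
    (T-∧⁺ (noLLLᵇ⁺ no-lll)
          (T-not⁺ λ t → let z , _ , run = anyBelow⁻ (runᵇ K) t in no-run z (runᵇ⁻ K run))))
    where open Format format

  towerᵇ⁻ : ∀ K → T (towerᵇ K) → Tower K
  towerᵇ⁻ K t = let format , distinct = T-∧⁻ {formatᵇ K} t in
    record { format = formatᵇ⁻ K format ; distinct = distinctBelowᵇ⁻ K distinct }

  towerᵇ⁺ : ∀ K → Tower K → T (towerᵇ K)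
  towerᵇ⁺ K tower = T-∧⁺ (formatᵇ⁺ K (Tower.format tower)) (distinctBelowᵇ⁺ K (Tower.distinct tower))

-- The upper bound

classTuples : ℕ → ℕ
classTuples zero = 1
classTuples (suc j) = tower (suc j) * classTuples j

module UpperBound (n : ℕ) (f : ℕ → Letter) (pad : ∀ p → n ≤ p → f p ≡ l)
                  (K : ℕ) (0<n : 0 < n) (model : Structure.Tower n f pad K) where
  open BoolSemantics n f
  open Classes n f
  open Structure n f pad
  open Tower model
  open Format format

  start : ℕ → ℕ → ℕ
  start j zero = zero
  start j (suc p) = if blockStartᵇ j (suc p) then suc p else start j p

  start-≤ : ∀ j p → start j p ≤ p
  start-≤ j zero = z≤n
  start-≤ j (suc p) with blockStartᵇ j (suc p)
  ... | true = ≤-refl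
  ... | false = m≤n⇒m≤1+n (start-≤ j p)

  start<n : ∀ j {p} → p < n → start j p < n
  start<n j {p} p<n = ≤-<-trans (start-≤ j p) p<n

  start-blockStart : ∀ j {p} → p < n → BlockStart j (start j p)
  start-blockStart j {p} p<n = blockStartᵇ⁻ j (start<n j p<n) (isStart p)
    where
    isStart : ∀ p → T (blockStartᵇ j (start j p))
    isStart zero = blockStartᵇ⁺ j 0<n (first-L 0<n , inj₁ refl)
    isStart (suc p) with blockStartᵇ j (suc p) in e
    ... | true = subst T (sym e) _
    ... | false = isStart p

  start-maximal : ∀ j {p u} → p < n → start j p < u → u ≤ p → ¬ BlockStart j u
  start-maximal j {p} {u} p<n s<u u≤p su = notStart p s<u u≤p (blockStartᵇ⁺ j (≤-<-trans u≤p p<n) su)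
    where
    notStart : ∀ p → start j p < u → u ≤ p → ¬ T (blockStartᵇ j u)
    notStart zero s<u u≤0 _ = <⇒≱ s<u u≤0
    notStart (suc p) s<u u≤sp with blockStartᵇ j (suc p) in e
    ... | true = λ _ → <⇒≱ s<u u≤sp
    ... | false with m≤n⇒m<n∨m≡n u≤sp
    ...   | inj₁ u<sp = notStart p s<u (s≤s⁻¹ u<sp)
    ...   | inj₂ refl = subst T e

  start-nested : ∀ j {p} → p < n → start (suc j) p ≤ start j p
  start-nested j {p} p<n with start (suc j) p ≤? start j p
  ... | yes ≤start = ≤start
  ... | no ≰start = ⊥-elim (start-maximal j p<n (≰⇒> ≰start) (start-≤ (suc j) p)
                                          (BlockStart-weaken (start-blockStart (suc j) p<n)))

  start-child : ∀ j {p} → p < n → Child j (start (suc j) p) (start j p)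
  start-child j {p} p<n = start-nested j p<n , start-blockStart j p<n , noRun
    where
    noRun : NoRun (suc j) (start (suc j) p) (start j p)
    noRun z x≤z z<u run =
      let y , z<y , y≤u , sy = BlockStart-after-run run z<u (proj₁ (start-blockStart j p<n))
      in start-maximal (suc j) p<n (≤-<-trans x≤z z<y) (≤-trans y≤u (start-≤ j p)) sy

  start-top : ∀ {p} → p < n → start K p ≡ 0
  start-top p<n = BlockStart-top no-run (start-blockStart K p<n)

  -- A 0-block is l or ll followed by at most K letters r.
  offset-bound : ∀ {p} → p < n → p < start 0 p + (3 + K)
  offset-bound {p} p<n with p <? start 0 p + (3 + K)
  ... | yes p<bound = p<bound
  ... | no p≮bound = ⊥-elim (short (≮⇒≥ p≮bound))
    where
    u : ℕ
    u = start 0 p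

    r-persists : ∀ {q} → u < q → IsR q → ∀ i → q + i ≤ p → IsR (q + i)
    r-persists {q} u<q rq zero _ = subst IsR (sym (+-identityʳ q)) rq
    r-persists {q} u<q rq (suc i) q+si≤p with letter (q + suc i)
    ... | inj₂ isR = isR
    ... | inj₁ isL′ =
      let q+i<q+si = +-monoʳ-< q (n<1+n i)
          ri = r-persists u<q rq i (≤-trans (<⇒≤ q+i<q+si) q+si≤p)
          y , q+i<y , y≤ , sy = BlockStart-after-run (Run-zero ri) q+i<q+si isL′
      in ⊥-elim (start-maximal 0 p<n (<-≤-trans u<q (≤-trans (m≤m+n q i) (<⇒≤ q+i<y)))
                                     (≤-trans y≤ q+si≤p) sy)

    run-from : ∀ {q} → u < q → q + K ≤ p → IsR q → Run K q
    run-from u<q q+K≤p rq i i≤K = r-persists u<q rq i (≤-trans (+-monoʳ-≤ _ i≤K) q+K≤p)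

    room : u + (3 + K) ≤ p → ∀ i → i ≤ 3 → i + u + K ≤ p
    room long i i≤3 = ≤-trans (≤-reflexive (trans (cong (_+ K) (+-comm i u)) (+-assoc u i K)))
                         (≤-trans (+-monoʳ-≤ u (+-monoˡ-≤ K i≤3)) long)

    short : u + (3 + K) ≤ p → ⊥
    short long with letter (1 + u) | letter (2 + u)
    ... | inj₂ r₁ | _ = no-run (1 + u) (run-from (n<1+n u) (room long 1 (s≤s z≤n)) r₁)
    ... | inj₁ _ | inj₂ r₂ = no-run (2 + u) (run-from (m<n⇒m<1+n (n<1+n u)) (room long 2 (s≤s (s≤s z≤n))) r₂)
    ... | inj₁ l₁ | inj₁ l₂ =
      no-lll u (≤-<-trans (≤-trans (m≤m+n (2 + u) K) (room long 2 (s≤s (s≤s z≤n)))) p<n)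
               (proj₁ (start-blockStart 0 p<n)) l₁ l₂

  chain : ∀ j → ℕ → Fin (classTuples j)
  chain zero p = zero
  chain (suc j) p = combine (class j (start j p)) (chain j p)

  chain-injective : ∀ j {p q} → chain j p ≡ chain j q → ∀ {i} → i < j → class i (start i p) ≡ class i (start i q)
  chain-injective (suc j) {p} {q} e i<sj
    with combine-injective (class j (start j p)) (chain j p) (class j (start j q)) (chain j q) e
       | m≤n⇒m<n∨m≡n (s≤s⁻¹ i<sj)
  ... | same , _ | inj₂ refl = same
  ... | _ , rest | inj₁ i<j = chain-injective j rest i<j

  starts-agree : ∀ {p q} → p < n → q < n → (∀ {i} → i < K → class i (start i p) ≡ class i (start i q)) →
                 ∀ d {j} → j + d ≡ K → start j p ≡ start j q
  starts-agree {p} {q} p<n q<n same zero {j} j+0≡K =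
    subst (λ j → start j p ≡ start j q) (trans (sym j+0≡K) (+-identityʳ j))
          (trans (start-top p<n) (sym (start-top q<n)))
  starts-agree {p} {q} p<n q<n same (suc d) {j} j+sd≡K =
    Distinct⇒child-unique (distinct j<K) (start<n j p<n) (start<n j q<n)
      (start-child j p<n) (subst (λ x → Child j x (start j q)) (sym parents) (start-child j q<n))
      (same j<K)
    where
    j<K : j < K
    j<K = <-≤-trans (m<m+n j z<s) (≤-reflexive j+sd≡K)
    parents : start (suc j) p ≡ start (suc j) q
    parents = starts-agree p<n q<n same d (trans (sym (+-suc j d)) j+sd≡K)

  offset : ∀ {p} → p < n → Fin (3 + K)
  offset {p} p<n = fromℕ< (m<n+o⇒m∸n<o p (start 0 p) (offset-bound p<n))

  code : Fin n → Fin ((3 + K) * classTuples K)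
  code i = combine (offset (toℕ<n i)) (chain K (toℕ i))

  code-injective : ∀ {i i′} → code i ≡ code i′ → i ≡ i′
  code-injective {i} {i′} e = toℕ-injective (begin
    toℕ i                                      ≡⟨ sym (m∸n+n≡m (start-≤ 0 (toℕ i))) ⟩
    toℕ i ∸ start 0 (toℕ i) + start 0 (toℕ i)   ≡⟨ cong₂ _+_ same-offset same-start ⟩
    toℕ i′ ∸ start 0 (toℕ i′) + start 0 (toℕ i′) ≡⟨ m∸n+n≡m (start-≤ 0 (toℕ i′)) ⟩
    toℕ i′                                     ∎)
    where
    open ≡-Reasoning
    parts : offset (toℕ<n i) ≡ offset (toℕ<n i′) × chain K (toℕ i) ≡ chain K (toℕ i′)
    parts = combine-injective (offset (toℕ<n i)) (chain K (toℕ i)) (offset (toℕ<n i′)) (chain K (toℕ i′)) e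
    same-offset : toℕ i ∸ start 0 (toℕ i) ≡ toℕ i′ ∸ start 0 (toℕ i′)
    same-offset = trans (sym (toℕ-fromℕ< _)) (trans (cong toℕ (proj₁ parts)) (toℕ-fromℕ< _))
    same-start : start 0 (toℕ i) ≡ start 0 (toℕ i′)
    same-start = starts-agree (toℕ<n i) (toℕ<n i′) (chain-injective K (proj₂ parts)) K refl

  length-bound : n ≤ (3 + K) * classTuples K
  length-bound = injective⇒≤ code-injective

module Embedding
  (N : ℕ) (fW : ℕ → Letter) (padW : ∀ p → N ≤ p → fW p ≡ l)
  (m : ℕ) (fM : ℕ → Letter) (padM : ∀ p → m ≤ p → fM p ≡ l)
  (a g : ℕ) (0<g : 0 < g) (0<m : 0 < m)
  (inside : ∀ {u} → u < m → fW (a + u) ≡ fM u)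
  (fits : a + m ≤ N)
  (left : a ≡ 0 ⊎ g ≤ a × (∀ {p} → a ∸ g ≤ p → p < a → fW p ≡ r))
  (right : a + m ≡ N ⊎ a + m + g ≤ N × (∀ {i} → i < g → fW (a + m + i) ≡ r))
  (first-L : fM 0 ≡ l) (last-L : ∀ {u} → suc u ≡ m → fM u ≡ l)
  where

  module W = Structure N fW padW
  module M = Structure m fM padM

  a+<N : ∀ {u} → u < m → a + u < N
  a+<N u<m = <-≤-trans (+-monoʳ-< a u<m) fits

  L-W⇒M : ∀ {u} → u < m → W.IsL (a + u) → M.IsL u
  L-W⇒M u<m lw = trans (sym (inside u<m)) lw

  L-M⇒W : ∀ {u} → u < m → M.IsL u → W.IsL (a + u)
  L-M⇒W u<m lm = trans (inside u<m) lm

  R-W⇒M : ∀ {u} → u < m → W.IsR (a + u) → M.IsR u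
  R-W⇒M u<m rw = trans (sym (inside u<m)) rw

  R-M⇒W : ∀ {u} → M.IsR u → W.IsR (a + u)
  R-M⇒W rm = trans (inside (M.IsR⇒<n rm)) rm

  shift : ∀ {p} → a ≤ p → p ≡ a + (p ∸ a)
  shift a≤p = sym (m+[n∸m]≡n a≤p)

  not-R-at-a : ¬ W.IsR a
  not-R-at-a ra = M.L≢R first-L (R-W⇒M 0<m (subst W.IsR (sym (+-identityʳ a)) ra))

  suc-pred-m : suc (pred m) ≡ m
  suc-pred-m = suc-pred m ⦃ >-nonZero 0<m ⦄

  not-R-at-end : ¬ W.IsR (a + pred m)
  not-R-at-end isR = M.L≢R (last-L suc-pred-m) (R-W⇒M (≤-reflexive suc-pred-m) isR)

  run-inside : ∀ {k z} → z < m → W.Run k (a + z) → ∀ {i} → i ≤ k → z + i < m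
  run-inside {k} {z} z<m run {i} i≤k with z + i <? m
  ... | yes z+i<m = z+i<m
  ... | no z+i≮m = ⊥-elim (not-R-at-end (subst W.IsR (trans (+-assoc a z i′) (cong (a +_) z+i′≡end)) (run i′ i′≤k)))
    where
    i′ : ℕ
    i′ = pred m ∸ z
    z+i′≡end : z + i′ ≡ pred m
    z+i′≡end = m+[n∸m]≡n (suc[m]≤n⇒m≤pred[n] z<m)
    i′≤k : i′ ≤ k
    i′≤k = ≤-trans (<⇒≤ (+-cancelˡ-< z i′ i (subst (_< z + i) (sym z+i′≡end)
                          (<-≤-trans (≤-reflexive suc-pred-m) (≮⇒≥ z+i≮m))))) i≤k

  Run-W⇒M : ∀ {k z} → z < m → W.Run k (a + z) → M.Run k z
  Run-W⇒M {z = z} z<m run i i≤k = R-W⇒M (run-inside z<m run i≤k) (subst W.IsR (+-assoc a z i) (run i i≤k))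

  Run-M⇒W : ∀ {k z} → M.Run k z → W.Run k (a + z)
  Run-M⇒W {z = z} run i i≤k = subst W.IsR (sym (+-assoc a z i)) (R-M⇒W (run i i≤k))

  BlockStart-W⇒M : ∀ j {u} → u < m → W.BlockStart j (a + u) → M.BlockStart j u
  BlockStart-W⇒M j {zero} _ _ = first-L , inj₁ refl
  BlockStart-W⇒M j {suc u} _ (_ , inj₁ a+su≡0) = ⊥-elim (1+n≢0 (trans (sym (+-suc a u)) a+su≡0))
  BlockStart-W⇒M j {suc u} su<m (lw , inj₂ (z′ , z′<a+su , run , only)) =
    L-W⇒M su<m lw ,
    inj₂ (z′ ∸ a , z<su , Run-W⇒M (<-trans z<su su<m) (subst (W.Run j) (shift a≤z′) run) , onlyM)
    where
    a≤z′ : a ≤ z′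
    a≤z′ with a ≤? z′
    ... | yes a≤z′ = a≤z′
    ... | no a≰z′ = ⊥-elim (not-R-at-a (only a (<⇒≤ (≰⇒> a≰z′)) (m<m+n a z<s)))
    z<su : z′ ∸ a < suc u
    z<su = +-cancelˡ-< a _ _ (subst (_< a + suc u) (shift a≤z′) z′<a+su)
    onlyM : M.OnlyR (z′ ∸ a) (suc u)
    onlyM y z≤y y<su =
      R-W⇒M (<-trans y<su su<m)
            (only (a + y) (subst (_≤ a + y) (sym (shift a≤z′)) (+-monoʳ-≤ a z≤y)) (+-monoʳ-< a y<su))

  BlockStart-M⇒W : ∀ j {u} → j < g → u < m → M.BlockStart j u → W.BlockStart j (a + u)
  BlockStart-M⇒W j {u} _ u<m (lm , inj₂ (z , z<u , run , only)) =
    L-M⇒W u<m lm , inj₂ (a + z , +-monoʳ-< a z<u , Run-M⇒W run , onlyW)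
    where
    onlyW : W.OnlyR (a + z) (a + u)
    onlyW y a+z≤y y<a+u =
      let a≤y = ≤-trans (m≤m+n a z) a+z≤y
      in subst W.IsR (sym (shift a≤y))
           (R-M⇒W (only (y ∸ a) (+-cancelˡ-≤ a _ _ (subst (a + z ≤_) (shift a≤y) a+z≤y))
                                (+-cancelˡ-< a _ _ (subst (_< a + u) (shift a≤y) y<a+u))))
  BlockStart-M⇒W j j<g u<m (lm , inj₁ refl) = L-M⇒W u<m lm , at-left left
    where
    at-left : a ≡ 0 ⊎ g ≤ a × (∀ {p} → a ∸ g ≤ p → p < a → fW p ≡ r) → a + 0 ≡ 0 ⊎ W.Preceded j (a + 0)
    at-left (inj₁ a≡0) = inj₁ (trans (+-identityʳ a) a≡0)
    at-left (inj₂ (g≤a , guard)) =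
      inj₂ (a ∸ suc j , <-≤-trans (≤-<-trans (m≤m+n _ 0) (before-a z≤n)) (m≤m+n a 0) , run , onlyW)
      where
      before-a : ∀ {i} → i ≤ j → a ∸ suc j + i < a
      before-a i≤j = <-≤-trans (+-monoʳ-< (a ∸ suc j) (s≤s i≤j)) (≤-reflexive (m∸n+n≡m (≤-trans j<g g≤a)))
      in-guard : ∀ {p} → a ∸ suc j ≤ p → p < a → W.IsR p
      in-guard start≤p p<a = guard (≤-trans (∸-monoʳ-≤ a j<g) start≤p) p<a
      run : W.Run j (a ∸ suc j)
      run i i≤j = in-guard (m≤m+n _ i) (before-a i≤j)
      onlyW : W.OnlyR (a ∸ suc j) (a + 0)
      onlyW y start≤y y<a = in-guard start≤y (subst (y <_) (+-identityʳ a) y<a)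

  NoRun-W⇒M : ∀ {k x u} → W.NoRun k (a + x) (a + u) → M.NoRun k x u
  NoRun-W⇒M noRun z x≤z z<u run = noRun (a + z) (+-monoʳ-≤ a x≤z) (+-monoʳ-< a z<u) (Run-M⇒W run)

  NoRun-M⇒W : ∀ {k x u} → u ≤ m → M.NoRun k x u → W.NoRun k (a + x) (a + u)
  NoRun-M⇒W {k} {x} {u} u≤m noRun z′ a+x≤z′ z′<a+u run =
    noRun (z′ ∸ a) (+-cancelˡ-≤ a x _ (subst (a + x ≤_) z′≡ a+x≤z′)) z<u
          (Run-W⇒M (<-≤-trans z<u u≤m) (subst (W.Run k) z′≡ run))
    where
    z′≡ : z′ ≡ a + (z′ ∸ a)
    z′≡ = shift (≤-trans (m≤m+n a x) a+x≤z′)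
    z<u : z′ ∸ a < u
    z<u = +-cancelˡ-< a _ u (subst (_< a + u) z′≡ z′<a+u)

  Child-W⇒M : ∀ j {x u} → u < m → W.Child j (a + x) (a + u) → M.Child j x u
  Child-W⇒M j u<m (x≤u , su , noRun) = +-cancelˡ-≤ a _ _ x≤u , BlockStart-W⇒M j u<m su , NoRun-W⇒M noRun

  Child-M⇒W : ∀ j {x u} → j < g → u < m → M.Child j x u → W.Child j (a + x) (a + u)
  Child-M⇒W j j<g u<m (x≤u , su , noRun) =
    +-monoʳ-≤ a x≤u , BlockStart-M⇒W j j<g u<m su , NoRun-M⇒W (<⇒≤ u<m) noRun

  Siblings-W⇒M : ∀ j {u v} → v < m → W.Siblings j (a + u) (a + v) → M.Siblings j u v
  Siblings-W⇒M j {u} {v} v<m (su , sv , u<v , noRun) =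
    BlockStart-W⇒M j (<-trans u<v′ v<m) su , BlockStart-W⇒M j v<m sv , u<v′ , NoRun-W⇒M noRun
    where
    u<v′ : u < v
    u<v′ = +-cancelˡ-< a _ _ u<v

  after-end : a + m ≡ N ⊎ (∀ {i} → i < g → W.IsR (a + m + i))
  after-end = map₂ proj₂ right

  after-not-L : a + m < N → ¬ W.IsL (a + m)
  after-not-L a+m<N lw with after-end
  ... | inj₁ a+m≡N = <-irrefl a+m≡N a+m<N
  ... | inj₂ guard = W.L≢R lw (subst W.IsR (+-identityʳ (a + m)) (guard 0<g))

  child-inside : ∀ j {x v} → suc j < g → x < m → v < N → W.Child j (a + x) v → ∃ λ u → u < m × v ≡ a + u
  child-inside j {x} {v} sj<g x<m v<N (a+x≤v , sv , noRun) with v <? a + m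
  ... | yes v<a+m = v ∸ a , +-cancelˡ-< a _ _ (subst (_< a + m) (shift a≤v) v<a+m) , shift a≤v
    where
    a≤v : a ≤ v
    a≤v = ≤-trans (m≤m+n a x) a+x≤v
  ... | no v≮a+m with m≤n⇒m<n∨m≡n (≮⇒≥ v≮a+m) | after-end
  ...   | inj₂ refl | _ = ⊥-elim (after-not-L v<N (proj₁ sv))
  ...   | inj₁ a+m<v | inj₁ a+m≡N = ⊥-elim (<-irrefl refl (<-trans a+m<v (subst (v <_) (sym a+m≡N) v<N)))
  ...   | inj₁ a+m<v | inj₂ guard =
    ⊥-elim (noRun (a + m) (+-monoʳ-≤ a (<⇒≤ x<m)) a+m<v λ i i≤sj → guard (≤-<-trans i≤sj sj<g))

  NextL-W⇒M : ∀ {x} → x < m → W.NextL (a + x) → M.NextL x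
  NextL-W⇒M {x} x<m (sx<N , lsx) with suc x <? m
  ... | yes sx<m = sx<m , L-W⇒M sx<m (subst W.IsL (sym (+-suc a x)) lsx)
  ... | no sx≮m = ⊥-elim (after-not-L (subst (_< N) end sx<N) (subst W.IsL end lsx))
    where
    end : suc (a + x) ≡ a + m
    end = trans (sym (+-suc a x)) (cong (a +_) (≤-antisym x<m (≮⇒≥ sx≮m)))

  NextL-M⇒W : ∀ {x} → M.NextL x → W.NextL (a + x)
  NextL-M⇒W {x} (sx<m , lsx) = subst (_< N) (+-suc a x) (a+<N sx<m) , subst W.IsL (+-suc a x) (L-M⇒W sx<m lsx)

  module CW = Classes N fW
  module CM = Classes m fM

  class-local : ∀ j {x} → j < g → x < m → CW.class j (a + x) ≡ CM.class j x
  class-local zero _ x<m =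
    cong bit (T-ext (M.nextLᵇ⁺ ∘ NextL-W⇒M x<m ∘ W.nextLᵇ⁻) (W.nextLᵇ⁺ ∘ NextL-M⇒W ∘ M.nextLᵇ⁻))
  class-local (suc j) {x} sj<g x<m = encode-cong λ c → T-ext (W⇒M c) (M⇒W c)
    where
    j<g : j < g
    j<g = <-trans (n<1+n j) sj<g
    W⇒M : ∀ c → T (CW.childClasses j (a + x) c) → T (CM.childClasses j x c)
    W⇒M c t with CW.childClasses⁻ j (a + x) c t
    ... | v , v<N , cv , vc with child-inside j sj<g x<m v<N (W.childᵇ⁻ j v<N cv)
    ...   | u , u<m , refl =
      subst (T ∘ CM.childClasses j x) (trans (sym (class-local j j<g u<m)) vc)
            (CM.childClasses⁺ j x u<m (M.childᵇ⁺ j u<m (Child-W⇒M j u<m (W.childᵇ⁻ j v<N cv))))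
    M⇒W : ∀ c → T (CM.childClasses j x c) → T (CW.childClasses j (a + x) c)
    M⇒W c t with CM.childClasses⁻ j x c t
    ... | u , u<m , cu , uc =
      subst (T ∘ CW.childClasses j (a + x)) (trans (class-local j j<g u<m) uc)
            (CW.childClasses⁺ j (a + x) (a+<N u<m)
              (W.childᵇ⁺ j (a+<N u<m) (Child-M⇒W j j<g u<m (M.childᵇ⁻ j u<m cu))))

-- Joining models

letterAt : List Letter → ℕ → Letter
letterAt [] _ = l
letterAt (c ∷ cs) zero = c
letterAt (c ∷ cs) (suc p) = letterAt cs p

letterAt-pad : ∀ cs p → length cs ≤ p → letterAt cs p ≡ l
letterAt-pad [] p _ = refl
letterAt-pad (c ∷ cs) (suc p) (s≤s len≤p) = letterAt-pad cs p len≤p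

letterAt-++ˡ : ∀ xs ys {p} → p < length xs → letterAt (xs ++ ys) p ≡ letterAt xs p
letterAt-++ˡ (x ∷ xs) ys {zero} _ = refl
letterAt-++ˡ (x ∷ xs) ys {suc p} (s≤s p<len) = letterAt-++ˡ xs ys p<len

letterAt-++ʳ : ∀ xs ys p → letterAt (xs ++ ys) (length xs + p) ≡ letterAt ys p
letterAt-++ʳ [] ys p = refl
letterAt-++ʳ (x ∷ xs) ys p = letterAt-++ʳ xs ys p

letterAt-replicate : ∀ g {i} → i < g → letterAt (replicate g r) i ≡ r
letterAt-replicate (suc g) {zero} _ = refl
letterAt-replicate (suc g) {suc i} (s≤s i<g) = letterAt-replicate g i<g

module ListWord (xs : List Letter) where
  open BoolSemantics (length xs) (letterAt xs) public
  open Classes (length xs) (letterAt xs) public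
  open Structure (length xs) (letterAt xs) (letterAt-pad xs) public

IsModel : ℕ → List Letter → Set
IsModel K xs = 0 < length xs × ListWord.Tower xs K

topClass : ∀ K → List Letter → Fin (tower (suc K))
topClass K xs = ListWord.class xs K 0

module Concatenation (K : ℕ) where

  separator : List Letter
  separator = replicate (suc K) r

  record Joined (W : List Letter) (Ls : List (List Letter)) : Set where
    field
      nonempty : 0 < length W
      isTower : ListWord.Tower W (suc K)
      starts-in : ∀ {u} → u < length W → ListWord.BlockStart W K u → ListWord.class W K u ∈ map (topClass K) Ls
      starts-cover : ∀ {c} → c ∈ map (topClass K) Ls →
                     ∃ λ u → u < length W × ListWord.BlockStart W K u × ListWord.class W K u ≡ c

  single : ∀ {M} → IsModel K M → Joined M (M ∷ [])
  single {M} (0<n , model) = record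
    { nonempty = 0<n
    ; isTower = record
      { format = record
        { first-L = first-L ; last-L = last-L ; no-lll = no-lll
        ; no-run = λ z → no-run z ∘ Run-weaken (n≤1+n K) }
      ; distinct = distinct′ }
    ; starts-in = λ _ su → here (cong (class K) (BlockStart-top no-run su))
    ; starts-cover = λ { (here refl) → 0 , 0<n , (first-L 0<n , inj₁ refl) , refl }
    }
    where
    open ListWord M
    open Tower model
    open Format format
    distinct′ : DistinctBelow (suc K)
    distinct′ j<sK with m≤n⇒m<n∨m≡n (s≤s⁻¹ j<sK)
    ... | inj₁ j<K = distinct j<K
    ... | inj₂ refl = λ _ (su , sv , u<v , _) _ →
      <-irrefl (trans (BlockStart-top no-run su) (sym (BlockStart-top no-run sv))) u<v

  module Step (M W′ : List Letter) (Ls′ : List (List Letter))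
              (modelM : IsModel K M) (joined′ : Joined W′ Ls′) (fresh : topClass K M ∉ map (topClass K) Ls′) where

    W : List Letter
    W = M ++ separator ++ W′

    private
      module WW = ListWord W
      module WM = ListWord M
      module WW′ = ListWord W′
      open Joined joined′
      formatM : WM.Format K
      formatM = WM.Tower.format (proj₂ modelM)
      formatW′ : WW′.Format (suc K)
      formatW′ = WW′.Tower.format isTower

    a′ : ℕ
    a′ = length M + suc K

    a′+len≡len : a′ + length W′ ≡ length W
    a′+len≡len = begin
      length M + suc K + length W′              ≡⟨ +-assoc (length M) (suc K) (length W′) ⟩
      length M + (suc K + length W′)            ≡⟨ cong (λ s → length M + (s + length W′)) (sym (length-replicate (suc K))) ⟩
      length M + (length separator + length W′) ≡⟨ cong (length M +_) (sym (length-++ separator)) ⟩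
      length M + length (separator ++ W′)       ≡⟨ sym (length-++ M) ⟩
      length W ∎
      where open ≡-Reasoning

    letter-sep : ∀ {i} → i < suc K → letterAt W (length M + i) ≡ r
    letter-sep {i} i<sK =
      trans (letterAt-++ʳ M (separator ++ W′) i)
            (trans (letterAt-++ˡ separator W′ (subst (i <_) (sym (length-replicate (suc K))) i<sK))
                   (letterAt-replicate (suc K) i<sK))

    sep-R : ∀ {p} → length M ≤ p → p < a′ → WW.IsR p
    sep-R {p} lenM≤p p<a′ =
      subst WW.IsR (m+[n∸m]≡n lenM≤p)
            (letter-sep (+-cancelˡ-< (length M) _ _ (subst (_< a′) (sym (m+[n∸m]≡n lenM≤p)) p<a′)))

    letter-W′ : ∀ {q} → q < length W′ → letterAt W (a′ + q) ≡ letterAt W′ q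
    letter-W′ {q} _ =
      trans (cong (letterAt W) (+-assoc (length M) (suc K) q))
            (trans (letterAt-++ʳ M (separator ++ W′) (suc K + q))
                   (subst (λ s → letterAt (separator ++ W′) (s + q) ≡ letterAt W′ q) (length-replicate (suc K))
                          (letterAt-++ʳ separator W′ q)))

    module EM = Embedding (length W) (letterAt W) (letterAt-pad W) (length M) (letterAt M) (letterAt-pad M)
                          0 (suc K) z<s (proj₁ modelM) (λ u<lenM → letterAt-++ˡ M (separator ++ W′) u<lenM)
                          (≤-trans (m≤m+n (length M) (suc K)) (≤-trans (m≤m+n a′ _) (≤-reflexive a′+len≡len)))
                          (inj₁ refl) (inj₂ (≤-trans (m≤m+n a′ _) (≤-reflexive a′+len≡len) , letter-sep))
                          (WM.Format.first-L formatM (proj₁ modelM)) (WM.Format.last-L formatM _)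

    module EW′ = Embedding (length W) (letterAt W) (letterAt-pad W) (length W′) (letterAt W′) (letterAt-pad W′)
                           a′ (suc K) z<s nonempty letter-W′ (≤-reflexive a′+len≡len)
                           (inj₂ (m≤n+m (suc K) (length M) ,
                                  λ lo hi → sep-R (subst (_≤ _) (m+n∸n≡m (length M) (suc K)) lo) hi))
                           (inj₁ a′+len≡len)
                           (WW′.Format.first-L formatW′ nonempty) (WW′.Format.last-L formatW′ _)

    data Region (p : ℕ) : Set where
      in-M : p < length M → Region p
      in-sep : length M ≤ p → p < a′ → Region p
      in-W′ : ∀ q → p ≡ a′ + q → Region p

    region : ∀ p → Region p
    region p with p <? length M | p <? a′
    ... | yes p<lenM | _ = in-M p<lenM
    ... | no p≮lenM | yes p<a′ = in-sep (≮⇒≥ p≮lenM) p<a′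
    ... | no _ | no p≮a′ = in-W′ (p ∸ a′) (sym (m+[n∸m]≡n (≮⇒≥ p≮a′)))

    in-W′-bound : ∀ {q} → a′ + q < length W → q < length W′
    in-W′-bound a′+q<N = +-cancelˡ-< a′ _ _ (subst (_ <_) (sym a′+len≡len) a′+q<N)

    not-L-in-sep : ∀ {p} → length M ≤ p → p < a′ → ¬ WW.IsL p
    not-L-in-sep lenM≤p p<a′ lp = WW.L≢R lp (sep-R lenM≤p p<a′)

    lenM<a′ : length M < a′
    lenM<a′ = m<m+n (length M) z<s

    a′<N : a′ < length W
    a′<N = <-≤-trans (m<m+n a′ nonempty) (≤-reflexive a′+len≡len)

    last-L : ∀ u → suc u ≡ length W → WW.IsL u
    last-L u su≡N with region u
    ... | in-M u<lenM = ⊥-elim (<-irrefl su≡N (≤-<-trans u<lenM (<-trans lenM<a′ a′<N)))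
    ... | in-sep _ u<a′ = ⊥-elim (<-irrefl su≡N (≤-<-trans u<a′ a′<N))
    ... | in-W′ q refl =
      EW′.L-M⇒W (in-W′-bound (≤-reflexive su≡N))
        (WW′.Format.last-L formatW′ q (+-cancelˡ-≡ a′ _ _ (trans (+-suc a′ q) (trans su≡N (sym a′+len≡len)))))

    no-lll : WW.NoLLL
    no-lll x ssx<N lx lsx lssx with region x
    ... | in-sep lo hi = not-L-in-sep lo hi lx
    ... | in-W′ q refl =
      WW′.Format.no-lll formatW′ q ssq<lenW′ (EW′.L-W⇒M q<lenW′ lx)
        (EW′.L-W⇒M sq<lenW′ (subst WW.IsL (sym (+-suc a′ q)) lsx))
        (EW′.L-W⇒M ssq<lenW′ (subst WW.IsL (sym (trans (+-suc a′ (suc q)) (cong suc (+-suc a′ q)))) lssx))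
      where
      ssq<lenW′ : suc (suc q) < length W′
      ssq<lenW′ = in-W′-bound (subst (_< length W) (sym (trans (+-suc a′ (suc q)) (cong suc (+-suc a′ q)))) ssx<N)
      sq<lenW′ : suc q < length W′
      sq<lenW′ = <-trans (n<1+n (suc q)) ssq<lenW′
      q<lenW′ : q < length W′
      q<lenW′ = <-trans (n<1+n q) sq<lenW′
    ... | in-M x<lenM with suc (suc x) <? length M | suc x <? length M
    ...   | yes ssx<lenM | _ =
      WM.Format.no-lll formatM x ssx<lenM (EM.L-W⇒M x<lenM lx)
        (EM.L-W⇒M (<-trans (n<1+n (suc x)) ssx<lenM) lsx) (EM.L-W⇒M ssx<lenM lssx)
    ...   | no ssx≮lenM | yes sx<lenM =
      not-L-in-sep (≮⇒≥ ssx≮lenM) (subst (_< a′) (sym (≤-antisym sx<lenM (≮⇒≥ ssx≮lenM))) lenM<a′) lssx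
    ...   | no _ | no sx≮lenM =
      not-L-in-sep (≮⇒≥ sx≮lenM) (subst (_< a′) (sym (≤-antisym x<lenM (≮⇒≥ sx≮lenM))) lenM<a′) lsx

    no-run : ∀ z → ¬ WW.Run (suc K) z
    no-run z run with region z
    ... | in-M z<lenM = WM.Format.no-run formatM z (WM.Run-weaken (n≤1+n K) (EM.Run-W⇒M z<lenM run))
    ... | in-W′ q refl = WW′.Format.no-run formatW′ q (EW′.Run-W⇒M (in-W′-bound (WW.IsR⇒<n (WW.Run-head run))) run)
    ... | in-sep lenM≤z z<a′ =
      EW′.not-R-at-a (subst WW.IsR (m+[n∸m]≡n (<⇒≤ z<a′)) (run (a′ ∸ z) a′∸z≤sK))
      where
      a′∸z≤sK : a′ ∸ z ≤ suc K
      a′∸z≤sK = ≤-trans (∸-monoʳ-≤ a′ lenM≤z) (≤-reflexive (m+n∸m≡n (length M) (suc K)))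

    format : WW.Format (suc K)
    format = record
      { first-L = λ _ → EM.L-M⇒W (proj₁ modelM) (WM.Format.first-L formatM (proj₁ modelM))
      ; last-L = last-L ; no-lll = no-lll ; no-run = no-run }

    top-M : ∀ {u} → u < length M → WW.BlockStart K u → u ≡ 0
    top-M u<lenM su = WM.BlockStart-top (WM.Format.no-run formatM) (EM.BlockStart-W⇒M K u<lenM su)

    class-M : WW.class K 0 ≡ topClass K M
    class-M = EM.class-local K (n<1+n K) (proj₁ modelM)

    class-W′ : ∀ {q} → q < length W′ → WW.class K (a′ + q) ≡ WW′.class K q
    class-W′ = EW′.class-local K (n<1+n K)

    distinct : WW.DistinctBelow (suc K)
    distinct {j} j<sK {u} {v} v<N sib@(su , sv , u<v , noRun) same with region u | region v
    ... | in-sep lo hi | _ = not-L-in-sep lo hi (proj₁ su)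
    ... | _ | in-sep lo hi = not-L-in-sep lo hi (proj₁ sv)
    ... | in-W′ q refl | in-M v<lenM = <-asym u<v (<-≤-trans v<lenM (<⇒≤ (<-≤-trans lenM<a′ (m≤m+n a′ q))))
    ... | in-W′ q refl | in-W′ q′ refl =
      WW′.Tower.distinct isTower j<sK (in-W′-bound v<N) (EW′.Siblings-W⇒M j (in-W′-bound v<N) sib)
        (trans (sym (EW′.class-local j j<sK (in-W′-bound (<-trans u<v v<N))))
               (trans same (EW′.class-local j j<sK (in-W′-bound v<N))))
    ... | in-M u<lenM | in-M v<lenM with m≤n⇒m<n∨m≡n (s≤s⁻¹ j<sK)
    ...   | inj₁ j<K =
      WM.Tower.distinct (proj₂ modelM) j<K v<lenM (EM.Siblings-W⇒M j v<lenM sib)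
        (trans (sym (EM.class-local j j<sK u<lenM)) (trans same (EM.class-local j j<sK v<lenM)))
    ...   | inj₂ refl = <-irrefl (trans (top-M u<lenM su) (sym (top-M v<lenM sv))) u<v
    distinct {j} j<sK {u} {v} v<N (su , sv , u<v , noRun) same | in-M u<lenM | in-W′ q′ refl
      with m≤n⇒m<n∨m≡n (s≤s⁻¹ j<sK)
    ... | inj₁ j<K = noRun (length M) (<⇒≤ u<lenM) (<-≤-trans lenM<a′ (m≤m+n a′ q′))
                           λ i i≤sj → letter-sep (≤-<-trans i≤sj (s≤s j<K))
    ... | inj₂ refl =
      fresh (subst (_∈ map (topClass K) Ls′) top-classes (starts-in q′<lenW′ (EW′.BlockStart-W⇒M K q′<lenW′ sv)))
      where
      q′<lenW′ : q′ < length W′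
      q′<lenW′ = in-W′-bound v<N
      top-classes : WW′.class K q′ ≡ topClass K M
      top-classes =
        trans (sym (class-W′ q′<lenW′)) (trans (sym same) (trans (cong (WW.class K) (top-M u<lenM su)) class-M))

    starts-in′ : ∀ {u} → u < length W → WW.BlockStart K u → WW.class K u ∈ map (topClass K) (M ∷ Ls′)
    starts-in′ {u} u<N su with region u
    ... | in-sep lo hi = ⊥-elim (not-L-in-sep lo hi (proj₁ su))
    ... | in-M u<lenM = here (trans (cong (WW.class K) (top-M u<lenM su)) class-M)
    ... | in-W′ q refl =
      there (subst (_∈ map (topClass K) Ls′) (sym (class-W′ q<lenW′))
                   (starts-in q<lenW′ (EW′.BlockStart-W⇒M K q<lenW′ su)))
      where
      q<lenW′ : q < length W′
      q<lenW′ = in-W′-bound u<N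

    starts-cover′ : ∀ {c} → c ∈ map (topClass K) (M ∷ Ls′) →
                    ∃ λ u → u < length W × WW.BlockStart K u × WW.class K u ≡ c
    starts-cover′ (here refl) =
      0 , EM.a+<N (proj₁ modelM) ,
      EM.BlockStart-M⇒W K (n<1+n K) (proj₁ modelM) (WM.Format.first-L formatM (proj₁ modelM) , inj₁ refl) ,
      class-M
    starts-cover′ (there c∈) =
      let q , q<lenW′ , sq , qc = starts-cover c∈
      in a′ + q , EW′.a+<N q<lenW′ , EW′.BlockStart-M⇒W K (n<1+n K) q<lenW′ sq , trans (class-W′ q<lenW′) qc

    joined : Joined W (M ∷ Ls′)
    joined = record
      { nonempty = EM.a+<N (proj₁ modelM)
      ; isTower = record { format = format ; distinct = distinct }
      ; starts-in = starts-in′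
      ; starts-cover = starts-cover′
      }

  join-models : ∀ M Ms → All (IsModel K) (M ∷ Ms) → Unique (map (topClass K) (M ∷ Ms)) →
                Joined (intercalate separator (M ∷ Ms)) (M ∷ Ms)
  join-models M [] models _ = single (All.head models)
  join-models M (M′ ∷ Ms) models unique =
    Step.joined M (intercalate separator (M′ ∷ Ms)) (M′ ∷ Ms) (All.head models)
                (join-models M′ Ms (All.tail models) (AllPairs.tail unique)) (UniqueP.Unique[x∷xs]⇒x∉xs unique)

  Joined⇒IsModel : ∀ {W Ls} → Joined W Ls → IsModel (suc K) W
  Joined⇒IsModel joined = Joined.nonempty joined , Joined.isTower joined

  topClass-children : ∀ {W Ls} → Joined W Ls → ∀ c → T (ListWord.childClasses W K 0 c) ⇔ c ∈ map (topClass K) Ls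
  topClass-children {W} {Ls} joined c = mk⇔ to from
    where
    open ListWord W
    open Joined joined
    to : T (childClasses K 0 c) → c ∈ map (topClass K) Ls
    to t = let u , u<n , child , uc = childClasses⁻ K 0 c t
           in subst (_∈ _) uc (starts-in u<n (proj₁ (proj₂ (childᵇ⁻ K {0} u<n child))))
    from : c ∈ map (topClass K) Ls → T (childClasses K 0 c)
    from c∈ = let u , u<n , su , uc = starts-cover c∈
              in subst (T ∘ childClasses K 0) uc
                   (childClasses⁺ K 0 u<n
                     (childᵇ⁺ K {0} u<n (z≤n , su , λ z _ _ → Format.no-run (Tower.format isTower) z)))

  length-join : ∀ M Ms → length Ms ≤ length (intercalate separator (M ∷ Ms))
  length-join M [] = z≤n
  length-join M (M′ ∷ Ms) = begin
    suc (length Ms)                                     ≤⟨ s≤s (length-join M′ Ms) ⟩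
    suc (length rest)                                   ≤⟨ m≤n+m (suc (length rest)) (length M + K) ⟩
    length M + K + suc (length rest)                    ≡⟨ lengths ⟩
    length (M ++ separator ++ rest)                     ∎
    where
    open ≤-Reasoning
    rest = intercalate separator (M′ ∷ Ms)
    lengths : length M + K + suc (length rest) ≡ length (M ++ separator ++ rest)
    lengths = begin-equality
      length M + K + suc (length rest)             ≡⟨ +-assoc (length M) K (suc (length rest)) ⟩
      length M + (K + suc (length rest))           ≡⟨ cong (length M +_) (+-suc K (length rest)) ⟩
      length M + (suc K + length rest)             ≡⟨ cong (λ s → length M + (s + length rest)) (sym (length-replicate (suc K))) ⟩
      length M + (length separator + length rest)  ≡⟨ cong (length M +_) (sym (length-++ separator)) ⟩
      length M + length (separator ++ rest)        ≡⟨ sym (length-++ M) ⟩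
      length (M ++ separator ++ rest)              ∎

record Family (K R : ℕ) : Set where
  field
    word : Fin R → List Letter
    model : ∀ i → IsModel K (word i)
    distinct : ∀ {i j} → topClass K (word i) ≡ topClass K (word j) → i ≡ j

module FromFamily {K R} (family : Family K (suc R)) where
  open Family family
  open Concatenation K

  models : ∀ is → All (IsModel K) (map word is)
  models is = AllP.map⁺ (All.universal model is)

  unique : ∀ {is} → Unique is → Unique (map (topClass K) (map word is))
  unique {is} u = subst Unique (map-∘ is) (UniqueP.map⁺ distinct u)

  class∈⇔index∈ : ∀ is i → topClass K (word i) ∈ map (topClass K) (map word is) ⇔ i ∈ is
  class∈⇔index∈ is i = mk⇔ to (∈-map⁺ (topClass K) ∘ ∈-map⁺ word)
    where
    to : topClass K (word i) ∈ map (topClass K) (map word is) → i ∈ is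
    to c∈ = let y , y∈ , c≡ = ∈-map⁻ (topClass K) c∈
                i′ , i′∈ , y≡ = ∈-map⁻ word y∈
            in subst (_∈ is) (sym (distinct (trans c≡ (cong (topClass K) y≡)))) i′∈

  -- word zero is always chosen, so that the joined list is nonempty; the other words are chosen by k.
  selected : Fin (2 ^ R) → Fin (suc R) → Bool
  selected k zero = true
  selected k (suc i) = decode k i

  chosen : Fin (2 ^ R) → List (Fin (suc R))
  chosen k = filter (T? ∘ selected k) (allFin (suc R))

  chosen⇔selected : ∀ k i → i ∈ chosen k ⇔ T (selected k i)
  chosen⇔selected k i =
    mk⇔ (proj₂ ∘ ∈-filter⁻ (T? ∘ selected k) {xs = allFin (suc R)})
        (∈-filter⁺ (T? ∘ selected k) {xs = allFin (suc R)} (∈-allFin i))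

  -- chosen k reduces to zero ∷ rest k, as join-models needs.
  later : Fin R → Fin (suc R)
  later = suc

  rest : Fin (2 ^ R) → List (Fin (suc R))
  rest k = filter (T? ∘ selected k) (tabulate later)

  joined-at : ∀ k → Joined (intercalate separator (map word (chosen k))) (map word (chosen k))
  joined-at k = join-models (word zero) (map word (rest k)) (models (chosen k))
                           (unique (UniqueP.filter⁺ (T? ∘ selected k) (UniqueP.allFin⁺ (suc R))))

  powerFamily : Family (suc K) (2 ^ R)
  powerFamily = record
    { word = λ k → intercalate separator (map word (chosen k))
    ; model = Joined⇒IsModel ∘ joined-at
    ; distinct = λ e → decode-injective λ i →
        T-ext (transfer (encode-injective e) i) (transfer (sym ∘ encode-injective e) i)
    }
    where
    transfer : ∀ {k k′} → (∀ c → ListWord.childClasses (intercalate separator (map word (chosen k))) K 0 c ≡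
                                   ListWord.childClasses (intercalate separator (map word (chosen k′))) K 0 c) →
               ∀ i → T (decode k i) → T (decode k′ i)
    transfer {k} {k′} same i t =
      Equivalence.to (chosen⇔selected k′ (suc i))
        (Equivalence.to (class∈⇔index∈ (chosen k′) (suc i))
          (Equivalence.to (topClass-children (joined-at k′) _)
            (subst T (same _)
              (Equivalence.from (topClass-children (joined-at k) _)
                (Equivalence.from (class∈⇔index∈ (chosen k) (suc i))
                  (Equivalence.from (chosen⇔selected k (suc i)) t))))))

  long-model : Σ (List Letter) λ W → IsModel (suc K) W × R ≤ length W
  long-model =
    W , Joined⇒IsModel joined ,
    subst (_≤ length W) (trans (length-map word (tabulate later)) (length-tabulate later))
          (length-join (word zero) (map word (tabulate later)))
    where
    W : List Letter
    W = intercalate separator (map word (allFin (suc R)))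
    joined : Joined W (map word (allFin (suc R)))
    joined = join-models (word zero) (map word (tabulate later)) (models (allFin (suc R)))
                         (unique (UniqueP.allFin⁺ (suc R)))

baseFamily : Family 1 3
baseFamily = record { word = word ; model = model ; distinct = distinct }
  where
  -- 1-blocks whose children have the classes {l}, {ll} and {l, ll}
  word : Fin 3 → List Letter
  word zero = l ∷ []
  word (suc zero) = l ∷ l ∷ []
  word (suc (suc zero)) = l ∷ r ∷ l ∷ l ∷ []
  model : ∀ i → IsModel 1 (word i)
  model zero = z<s , ListWord.towerᵇ⁻ (word zero) 1 _
  model (suc zero) = z<s , ListWord.towerᵇ⁻ (word (suc zero)) 1 _
  model (suc (suc zero)) = z<s , ListWord.towerᵇ⁻ (word (suc (suc zero))) 1 _
  distinct : ∀ {i j} → topClass 1 (word i) ≡ topClass 1 (word j) → i ≡ j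
  distinct {zero} {zero} _ = refl
  distinct {zero} {suc zero} ()
  distinct {zero} {suc (suc zero)} ()
  distinct {suc zero} {zero} ()
  distinct {suc zero} {suc zero} _ = refl
  distinct {suc zero} {suc (suc zero)} ()
  distinct {suc (suc zero)} {zero} ()
  distinct {suc (suc zero)} {suc zero} ()
  distinct {suc (suc zero)} {suc (suc zero)} _ = refl

-- suc (familySize (suc t)) ≡ 2 ^ familySize t, the size of the family produced by powerFamily.
familySize : ℕ → ℕ
familySize zero = 2
familySize (suc t) = pred (2 ^ familySize t)

families : ∀ t → Family (suc t) (suc (familySize t))
families zero = baseFamily
families (suc t) = subst (Family (2 + t)) (sym (suc-pred (2 ^ familySize t) ⦃ m^n≢0 2 (familySize t) ⦄))
                         (FromFamily.powerFamily (families t))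

1≤tower : ∀ t → 1 ≤ tower t
1≤tower zero = ≤-refl
1≤tower (suc t) = m^n>0 2 (tower t)

tower<familySize : ∀ t → tower t < familySize t
tower<familySize zero = s≤s (s≤s z≤n)
tower<familySize (suc t) = suc[m]≤n⇒m≤pred[n] (begin
  2 + X               ≤⟨ +-monoˡ-≤ X (^-monoʳ-≤ 2 (1≤tower t)) ⟩
  X + X               ≡⟨ cong (X +_) (sym (+-identityʳ X)) ⟩
  2 ^ suc (tower t)   ≤⟨ ^-monoʳ-≤ 2 (tower<familySize t) ⟩
  2 ^ familySize t    ∎)
  where
  open ≤-Reasoning
  X : ℕ
  X = 2 ^ tower t

n<2^n : ∀ n → n < 2 ^ n
n<2^n zero = z<s
n<2^n (suc n) = begin-strict
  suc n           ≡⟨ +-comm 1 n ⟩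
  n + 1           <⟨ +-mono-<-≤ (n<2^n n) (m^n>0 2 n) ⟩
  2 ^ n + 2 ^ n   ≡⟨ cong (2 ^ n +_) (sym (+-identityʳ (2 ^ n))) ⟩
  2 ^ suc n       ∎
  where open ≤-Reasoning

tower-mono : ∀ {a b} → a ≤ b → tower a ≤ tower b
tower-mono {b = zero} z≤n = ≤-refl
tower-mono {a} {suc b} a≤sb with m≤n⇒m<n∨m≡n a≤sb
... | inj₂ refl = ≤-refl
... | inj₁ a<sb = ≤-trans (tower-mono (s≤s⁻¹ a<sb)) (<⇒≤ (n<2^n (tower b)))

-- The Hanf number

extend : ∀ {n} → (Fin n → Letter) → ℕ → Letter
extend {n} w p with p <? n
... | yes p<n = w (fromℕ< p<n)
... | no _ = l

extend-toℕ : ∀ {n} (w : Fin n → Letter) i → w i ≡ extend w (toℕ i)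
extend-toℕ {n} w i with toℕ i <? n
... | yes i<n = cong w (sym (fromℕ<-toℕ i i<n))
... | no i≮n = ⊥-elim (i≮n (toℕ<n i))

extend-pad : ∀ {n} (w : Fin n → Letter) p → n ≤ p → extend w p ≡ l
extend-pad {n} w p n≤p with p <? n
... | yes p<n = ⊥-elim (<⇒≱ p<n n≤p)
... | no _ = refl

models-are-short : ∀ K m → HasModelOfLength (towerF K) m → m ≤ (3 + K) * classTuples K
models-are-short K _ (k , refl , w , sat) =
  UpperBound.length-bound (suc k) (extend w) (extend-pad w) K z<s
    (Structure.towerᵇ⁻ (suc k) (extend w) (extend-pad w) K
      (Equivalence.from T-≡ (trans (sym (Eval.eval-towerF w (extend w) (extend-toℕ w) K (λ _ → zero))) sat)))

IsModel⇒HasModelOfLength : ∀ {K W} → IsModel K W → HasModelOfLength (towerF K) (length W)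
IsModel⇒HasModelOfLength {K} {x ∷ xs} (_ , model) = length xs , refl , w , sat
  where
  w : Word (length xs)
  w i = letterAt (x ∷ xs) (toℕ i)
  sat : w ⊨ towerF K
  sat = trans (Eval.eval-towerF w (letterAt (x ∷ xs)) (λ _ → refl) K (λ _ → zero))
              (Equivalence.to T-≡ (ListWord.towerᵇ⁺ (x ∷ xs) K model))

eval-cong : ∀ {n} {w w′ : Fin n → Letter} → (∀ i → w i ≡ w′ i) → ∀ a φ → eval w a φ ≡ eval w′ a φ
eval-cong w≗w′ a (lt′ x y) = refl
eval-cong w≗w′ a (eq′ x y) = refl
eval-cong w≗w′ a (Pl x) = cong isL (w≗w′ (a x))
eval-cong w≗w′ a (Pr x) = cong isR (w≗w′ (a x))
eval-cong w≗w′ a (and′ φ ψ) = cong₂ _∧_ (eval-cong w≗w′ a φ) (eval-cong w≗w′ a ψ)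
eval-cong w≗w′ a (or′ φ ψ) = cong₂ _∨_ (eval-cong w≗w′ a φ) (eval-cong w≗w′ a ψ)
eval-cong w≗w′ a (neg φ) = cong not (eval-cong w≗w′ a φ)
eval-cong {n} w≗w′ a (ex x φ) = cong or (map-cong (λ p → eval-cong w≗w′ (update a x p) φ) (allFin n))
eval-cong {n} w≗w′ a (all′ x φ) = cong and (map-cong (λ p → eval-cong w≗w′ (update a x p) φ) (allFin n))

letterBit : Letter → Fin 2
letterBit l = zero
letterBit r = suc zero

bitLetter : Fin 2 → Letter
bitLetter zero = l
bitLetter (suc zero) = r

wordOf : ∀ {k} → Fin (2 ^ suc k) → Word k
wordOf c i = bitLetter (finToFun c i)

wordOf-funToFin : ∀ {k} (w : Word k) i → wordOf (funToFin (letterBit ∘ w)) i ≡ w i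
wordOf-funToFin w i with w i | finToFun-funToFin (letterBit ∘ w) i
... | l | e = cong bitLetter e
... | r | e = cong bitLetter e

hasModel? : ∀ φ m → Dec (HasModelOfLength φ m)
hasModel? φ zero = no λ ()
hasModel? φ (suc k) with any? (λ c → eval (wordOf {k} c) (λ _ → zero) φ ≟ᵇ true)
... | yes (c , sat) = yes (k , refl , wordOf c , sat)
... | no none = no λ { (_ , refl , w , sat) →
  none (funToFin (letterBit ∘ w) , trans (eval-cong (wordOf-funToFin w) (λ _ → zero) φ) sat) }

greatest : ∀ (P : ℕ → Set) → (∀ m → Dec (P m)) → ∀ B → (∀ m → P m → m ≤ B) → ∀ {m₀} → P m₀ →
           Σ ℕ λ m → P m × (∀ m′ → P m′ → m′ ≤ m)
greatest P P? zero bounded p₀ = 0 , subst P (n≤0⇒n≡0 (bounded _ p₀)) p₀ , bounded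
greatest P P? (suc B) bounded p₀ with P? (suc B)
... | yes pB = suc B , pB , bounded
... | no ¬pB = greatest P P? B bounded′ p₀
  where
  bounded′ : ∀ m → P m → m ≤ B
  bounded′ m pm with m≤n⇒m<n∨m≡n (bounded m pm)
  ... | inj₁ m<sB = s≤s⁻¹ m<sB
  ... | inj₂ refl = ⊥-elim (¬pB pm)

longest-model : ∀ φ {B} → (∀ m → HasModelOfLength φ m → m ≤ B) → ∀ {m₀} → HasModelOfLength φ m₀ →
                Σ ℕ λ ν → IsNu φ ν × m₀ ≤ ν
longest-model φ bounded {m₀} has-m₀ =
  let ν , has-ν , ν-max = greatest (HasModelOfLength φ) (hasModel? φ) _ bounded has-m₀
  in ν , inj₁ (has-ν , ν-max) , ν-max m₀ has-m₀

-- 869 is the least c for which 6 c (1 + N)⁵ dominates the cubic of sz-towerF coefficientwise.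
towerF-size : ∀ N → sz (towerF (3 + N)) ≤ 869 * suc N ^ 5
towerF-size N = *-cancelˡ-≤ 6 (begin
  6 * sz (towerF (3 + N))
    ≡⟨ sz-towerF (3 + N) ⟩
  44 * (3 + N) * (3 + N) * (3 + N) + 273 * (3 + N) * (3 + N) + 427 * (3 + N) + 288
    ≤⟨ m≤m+n _ (22817 * N + 51471 * N * N + 52096 * N * N * N + 26070 * N * N * N * N + 5214 * N * N * N * N * N) ⟩
  44 * (3 + N) * (3 + N) * (3 + N) + 273 * (3 + N) * (3 + N) + 427 * (3 + N) + 288 +
  (22817 * N + 51471 * N * N + 52096 * N * N * N + 26070 * N * N * N * N + 5214 * N * N * N * N * N)
    ≡⟨ solve (N ∷ []) ⟩
  6 * (869 * ((1 + N) * ((1 + N) * ((1 + N) * ((1 + N) * ((1 + N) * 1)))))) ∎)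
  where
  open ≤-Reasoning

hanf-lower-bound : ∀ N {k} → k ≤ suc N → HanfFOAtLeast (869 * suc N ^ 5) (tower k)
hanf-lower-bound N {k} k≤sN with FromFamily.long-model (families (suc N))
... | W , model , long =
  let ν , isNu , W≤ν = longest-model (towerF (3 + N)) (models-are-short (3 + N))
                                      (IsModel⇒HasModelOfLength {W = W} model)
  in towerF (3 + N) , towerF-sentence (3 + N) , towerF-size N , ν , isNu , ≤-trans tower≤length W≤ν
  where
  tower≤length : tower k ≤ length W
  tower≤length = begin
    tower k              ≤⟨ tower-mono k≤sN ⟩
    tower (suc N)        ≤⟨ <⇒≤ (tower<familySize (suc N)) ⟩
    familySize (suc N)   ≤⟨ long ⟩
    length W             ∎
    where open ≤-Reasoning

corollary5 : Σ ℕ λ c → (1 ≤ c) × (∀ N → Σ ℕ λ n → (N ≤ n) ×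
               (∀ k → IsCeilFifthRoot n c k → HanfFOAtLeast n (tower k)))
corollary5 = 869 , s≤s z≤n , λ N →
  869 * suc N ^ 5 ,
  ≤-trans (n≤1+n N) (≤-trans (m≤m*n (suc N) (suc N ^ 4) ⦃ m^n≢0 (suc N) 4 ⦄) (m≤n*m _ 869)) ,
  λ k root → hanf-lower-bound N (proj₂ root (suc N) ≤-refl)
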